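{- Let $0\le q<s$ be integers. Then there is a Morse matching $\mathcal M$ on the digraph $\mathcal D(\Sigma(q,s))$ whose critical cells are all the elements of $\mathrm{NBFC}(q,s)$ together with exactly $\binom{s-1}{q}$ cells of dimension $2q-1$ (i.e. graphs with $2q$ edges) that are $q$-factor critical.
   Context: $\Sigma(q,s)$ is the full simplex whose vertex set is the edge set of the complete bipartite graph with bipartition $[q]\cup[\bar s]$, $[\bar s]=\{\bar1,\ldots,\bar s\}$; its faces (including the empty face) are identified with bipartite graphs on this bipartition via their edge sets, a face with $j$ edges having dimension $j-1$. $\mathcal D(\Sigma(q,s))$ is the digraph with one vertex for each face and an arc $(\sigma,\tau)$ whenever $\tau$ is obtained from $\sigma$ by removing one edge. A Morse matching on an acyclic digraph $\mathcal D$ is a set $\mathcal M$ of arcs such that (M1) each vertex is the head or tail of at most one arc of $\mathcal M$, and (M2) reversing the arcs of $\mathcal M$ yields a digraph with no directed cycle; critical cells are vertices not incident to any arc of $\mathcal M$. A bipartite graph with bipartition $X\cup Y$ is $q$-factor critical if $|X|=q$, $|Y|>q$ and for every $y\in Y$ the graph $G-y$ has a matching of size $q$ (here $X=[q]$, $Y=[\bar s]$). $\mathrm{NBFC}(q,s)$ is the set of bipartite graphs on $[q]\cup[\bar s]$ that are not $q$-factor critical. -}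

module Defs where

open import Data.Bool using (Bool; true; false)
open import Data.Nat using (ℕ; _<_; _+_)
open import Data.Fin using (Fin)
open import Data.Vec using (Vec; lookup; updateAt; _[_]≔_; countᵇ; map; foldr)
open import Data.List using (List; length)
open import Data.List.Relation.Unary.All using (All)
open import Data.List.Relation.Unary.AllPairs using (AllPairs)
open import Data.Product using (Σ; ∃; _×_; _,_; proj₁; proj₂)
open import Data.Sum using (_⊎_)
open import Relation.Binary.PropositionalEquality using (_≡_; _≢_)
open import Relation.Nullary using (¬_)
open import Relation.Binary.Construct.Closure.Transitive using (TransClosure)
open import Function using (id)

-- A face of Σ(q,s) = a bipartite graph on [q] ∪ [s̄], given by its edge set,
-- encoded as a q × s Boolean adjacency matrix (row i, column j̄).
-- Every such matrix is a face (including the empty face).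
Graph : ℕ → ℕ → Set
Graph q s = Vec (Vec Bool s) q

Edge : ∀ {q s} → Graph q s → Fin q → Fin s → Set
Edge G i j = lookup (lookup G i) j ≡ true

removeEdge : ∀ {q s} → Graph q s → Fin q → Fin s → Graph q s
removeEdge G i j = updateAt G i (λ row → row [ j ]≔ false)

-- number of edges (a face with k edges has dimension k - 1)
numEdges : ∀ {q s} → Graph q s → ℕ
numEdges G = foldr (λ _ → ℕ) (λ row acc → countᵇ id row + acc) 0 G

Arc : ∀ {q s} → Graph q s → Graph q s → Set
Arc σ τ = ∃ λ i → ∃ λ j → Edge σ i j × τ ≡ removeEdge σ i j

-- A set of arcs is a relation contained in Arc.
-- (M1) each vertex is head or tail of at most one arc of M.
Incident : ∀ {q s} → Graph q s → Graph q s → Graph q s → Set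
Incident v a b = (v ≡ a) ⊎ (v ≡ b)

M1 : ∀ {q s} → (Graph q s → Graph q s → Set) → Set
M1 {q} {s} M = ∀ (a b c d v : Graph q s) → M a b → M c d →
  Incident v a b → Incident v c d → (a ≡ c) × (b ≡ d)

Reversed : ∀ {q s} → (Graph q s → Graph q s → Set) → Graph q s → Graph q s → Set
Reversed M u v = (Arc u v × ¬ M u v) ⊎ M v u

M2 : ∀ {q s} → (Graph q s → Graph q s → Set) → Set
M2 {q} {s} M = ∀ (u : Graph q s) → ¬ TransClosure (Reversed M) u u

record MorseMatching {q s : ℕ} (M : Graph q s → Graph q s → Set) : Set where
  field
    arcs    : ∀ σ τ → M σ τ → Arc σ τ
    matching : M1 M
    acyclic : M2 M

Critical : ∀ {q s} → (Graph q s → Graph q s → Set) → Graph q s → Set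
Critical M σ = ¬ (∃ λ τ → M σ τ ⊎ M τ σ)

deleteY : ∀ {q s} → Graph q s → Fin s → Fin q → Fin s → Set
deleteY G y i j = Edge G i j × j ≢ y

Disjoint : ∀ {q s} → (Fin q × Fin s) → (Fin q × Fin s) → Set
Disjoint (i₁ , j₁) (i₂ , j₂) = (i₁ ≢ i₂) × (j₁ ≢ j₂)

record Matching {q s : ℕ} (E : Fin q → Fin s → Set) : Set where
  field
    edges    : List (Fin q × Fin s)
    inGraph  : All (λ e → E (proj₁ e) (proj₂ e)) edges
    disjoint : AllPairs Disjoint edges

FactorCritical : ∀ {q s} → Graph q s → Set
FactorCritical {q} {s} G =
  (q < s) × (∀ (y : Fin s) → Σ (Matching (deleteY G y)) λ m → length (Matching.edges m) ≡ q)

NBFC : ∀ {q s} → Graph q s → Set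
NBFC G = ¬ FactorCritical G

-- By Hall's theorem, a graph on [q] ∪ [s̄] is q-factor critical exactly when it has surplus:
-- |N(S)| > |S| for every nonempty S ⊆ [q].  The surplus graphs are paired off by looking at
-- row 1 and column 1̄.  If column 1̄ is isolated, or is a pendant edge at row 1 whose only other
-- neighbour is 2̄, delete it and pair as in the smaller graph.  Otherwise toggle one fixed edge:
-- (1,2̄), the corner (1,1̄), or, when removing the corner destroys the surplus, an edge (m,z)
-- read off from the tight sets responsible.  What stays unpaired is built from the graph with no
-- rows by adding isolated columns and pendant paths, so Pascal's rule counts it and every pendant
-- path adds two edges.  Acyclicity comes from a potential, compared lexicographically, that
-- drops along every arc of the modified Hasse diagram: deleting an edge never raises the rank of
-- the case, and within a case the recursive potential or an edge count adjusted for the toggled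
-- edge breaks the tie.

module Submission where

open import Defs
open import Data.Bool using (Bool; true; false; not; _∨_)
open import Data.Bool.Properties using (not-involutive; ∨-zeroʳ; ∨-identityʳ) renaming (_≟_ to _≟ᵇ_)
open import Data.Fin using (Fin; zero; suc; toℕ; inject≤) renaming (_≤_ to _≤ᶠ_)
open import Data.Fin.Properties using (_≟_; toℕ-injective) renaming (≤-antisym to ≤ᶠ-antisym)
open import Data.Fin.Subset
  using (Subset; inside; outside; ⁅_⁆; ∣_∣; _⊆_; _⊂_; _∪_; _∩_; _─_; _-_; Nonempty; Empty)
  renaming (_∈_ to _∈ₛ_; _∉_ to _∉ₛ_; ⊥ to ∅; ⊤ to ⊤ₛ)
open import Data.Fin.Subset.Properties
  using (_∈?_; _⊂?_; nonempty?; anySubset?; Empty-unique; ∣⊥∣≡0; ∣⁅x⁆∣≡1; x∈⁅x⁆; x∈⁅y⁆⇒x≡y; ∈⊤; ∣⊤∣≡n;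
         ∣p∣≤n; ∣p∣≡n⇒p≡⊤; ∣p∣≤∣p∪q∣; ∣q∣≤∣p∪q∣; p⊆q⇒∣p∣≤∣q∣; p⊂q⇒∣p∣<∣q∣; p─⊥≡p; p─q⊆p; x∈p∧x∉q⇒x∈p─q;
         x∈p∧x≢y⇒x∈p-y; x∈p⇒∣p-x∣<∣p∣; p∩q≢∅⇒∣p─q∣<∣p∣; x∈p∪q⁺; x∈p∪q⁻; x∈p∩q⁺; x∈p∩q⁻; ∉⊥; ⊆-refl;
         ⊆-trans; p∩q⊆p; p∩q⊆q; ∩-identityʳ)
open import Data.List using (List; []; _∷_; length; filter; tabulate; _++_)
import Data.List as List
open import Data.List.Properties using (length-map; length-tabulate; length-++)
open import Data.List.Membership.Propositional using (_∈_)
open import Data.List.Membership.Propositional.Properties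
  using (∈-map⁺; ∈-map⁻; ∈-filter⁺; ∈-filter⁻; ∈-++⁺ˡ; ∈-++⁺ʳ; ∈-++⁻)
open import Data.List.Relation.Binary.Lex.Strict using (Lex-<; <-transitive; <-irreflexive; this; next)
import Data.List.Relation.Binary.Pointwise as Pointwise
open import Data.List.Relation.Unary.All using (All)
import Data.List.Relation.Unary.All as All
import Data.List.Relation.Unary.All.Properties as All
open import Data.List.Relation.Unary.Any using (here; there)
import Data.List.Relation.Unary.Any as Any
open import Data.List.Relation.Unary.AllPairs using (AllPairs; []; _∷_)
import Data.List.Relation.Unary.AllPairs as AllPairs
import Data.List.Relation.Unary.AllPairs.Properties as AllPairs
open import Data.List.Relation.Unary.Unique.Propositional using (Unique)
import Data.List.Relation.Unary.Unique.Propositional.Properties as Unique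
open import Data.Maybe using (Maybe; just; nothing)
import Data.Maybe as Maybe
open import Data.Maybe.Properties using (just-injective)
open import Data.Nat using (ℕ; zero; suc; _+_; _*_; _∸_; _≤_; _<_; _≤?_; _<?_; z≤n; s≤s; s≤s⁻¹)
open import Data.Nat.Properties
  using (≤-refl; ≤-trans; ≤-reflexive; ≤-antisym; <-≤-trans; <-trans; <-irrefl; <-asym; ≤⇒≯; <⇒≤; <⇒≱; ≰⇒>; n≮0;
         n≤1+n; m≤m+n; m≤n⇒m<n∨m≡n; +-comm; +-suc; +-identityʳ; *-suc; +-mono-≤; +-monoʳ-≤; +-cancelʳ-≤;
         module ≤-Reasoning)
  renaming (_≟_ to _≟ℕ_)
open import Data.Nat.Combinatorics using (_C_; nCk+nC[k+1]≡[n+1]C[k+1])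
open import Data.Product using (Σ; ∃; _×_; _,_; proj₁; proj₂)
import Data.Product as Product
open import Data.Sum using (_⊎_; inj₁; inj₂)
import Data.Sum as Sum
open import Data.Sum.Function.Propositional using (_⊎-⇔_)
open import Data.Vec
  using ([]; _∷_; here; there; head; tail; lookup; map; zipWith; updateAt; _[_]≔_; countᵇ)
open import Data.Vec.Properties
  using (∷-injective; ∷-injectiveˡ; lookup-zipWith; lookup-map; updateAt-id; updateAt-id-local; updateAt-updateAt;
         updateAt-cong-local; lookup∘updateAt; lookup∘updateAt′; lookup∘update; lookup∘update′; zipWith-replicate₁;
         lookup⇒[]=; []=⇒lookup)
open import Function using (id; _∘_; _⇔_; mk⇔; Equivalence)
import Function.Properties.Equivalence as ⇔
open import Relation.Binary.Construct.Closure.Transitive using (TransClosure; [_]; _∷_)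
open import Relation.Binary.PropositionalEquality
open import Relation.Nullary using (¬_; Dec; yes; no; does; contradiction)
open import Relation.Nullary.Decidable
  using (decidable-stable; ¬?; _→-dec_; _×-dec_; map′; dec-true; dec-false; True; toWitness)

private
  variable
    n q s : ℕ

-- Subsets of a finite set

false≢true : false ≢ true
false≢true ()

∣p∪q∣+∣p∩q∣≡∣p∣+∣q∣ : ∀ (p q : Subset n) → ∣ p ∪ q ∣ + ∣ p ∩ q ∣ ≡ ∣ p ∣ + ∣ q ∣
∣p∪q∣+∣p∩q∣≡∣p∣+∣q∣ []            []            = refl
∣p∪q∣+∣p∩q∣≡∣p∣+∣q∣ (inside  ∷ p) (inside  ∷ q) =
  cong suc (trans (+-suc _ _) (trans (cong suc (∣p∪q∣+∣p∩q∣≡∣p∣+∣q∣ p q)) (sym (+-suc _ _))))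
∣p∪q∣+∣p∩q∣≡∣p∣+∣q∣ (inside  ∷ p) (outside ∷ q) = cong suc (∣p∪q∣+∣p∩q∣≡∣p∣+∣q∣ p q)
∣p∪q∣+∣p∩q∣≡∣p∣+∣q∣ (outside ∷ p) (inside  ∷ q) = trans (cong suc (∣p∪q∣+∣p∩q∣≡∣p∣+∣q∣ p q)) (sym (+-suc _ _))
∣p∪q∣+∣p∩q∣≡∣p∣+∣q∣ (outside ∷ p) (outside ∷ q) = ∣p∪q∣+∣p∩q∣≡∣p∣+∣q∣ p q

∣p∪q∣≤∣p∣+∣q∣ : ∀ (p q : Subset n) → ∣ p ∪ q ∣ ≤ ∣ p ∣ + ∣ q ∣
∣p∪q∣≤∣p∣+∣q∣ p q = ≤-trans (m≤m+n _ _) (≤-reflexive (∣p∪q∣+∣p∩q∣≡∣p∣+∣q∣ p q))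

∣Empty∣≡0 : ∀ {p : Subset n} → Empty p → ∣ p ∣ ≡ 0
∣Empty∣≡0 {n} empty = trans (cong ∣_∣ (Empty-unique empty)) (∣⊥∣≡0 n)

∣p∪q∣≡∣p∣+∣q∣ : ∀ (p q : Subset n) → Empty (p ∩ q) → ∣ p ∪ q ∣ ≡ ∣ p ∣ + ∣ q ∣
∣p∪q∣≡∣p∣+∣q∣ p q disjoint = begin
  ∣ p ∪ q ∣                ≡⟨ +-identityʳ _ ⟨
  ∣ p ∪ q ∣ + 0            ≡⟨ cong (∣ p ∪ q ∣ +_) (∣Empty∣≡0 disjoint) ⟨
  ∣ p ∪ q ∣ + ∣ p ∩ q ∣    ≡⟨ ∣p∪q∣+∣p∩q∣≡∣p∣+∣q∣ p q ⟩
  ∣ p ∣ + ∣ q ∣            ∎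
  where open ≡-Reasoning

x∈p⇒⁅x⁆⊆p : ∀ {p : Subset n} {x} → x ∈ₛ p → ⁅ x ⁆ ⊆ p
x∈p⇒⁅x⁆⊆p {p = p} {x} x∈p y∈⁅x⁆ = subst (_∈ₛ p) (sym (x∈⁅y⁆⇒x≡y x y∈⁅x⁆)) x∈p

Nonempty⇒∣p∣>0 : ∀ {p : Subset n} → Nonempty p → 0 < ∣ p ∣
Nonempty⇒∣p∣>0 (x , x∈p) = <-≤-trans (≤-reflexive (sym (∣⁅x⁆∣≡1 x))) (p⊆q⇒∣p∣≤∣q∣ (x∈p⇒⁅x⁆⊆p x∈p))

∣p∣>0⇒Nonempty : ∀ {p : Subset n} → 0 < ∣ p ∣ → Nonempty p
∣p∣>0⇒Nonempty {p = p} ∣p∣>0 with nonempty? p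
... | yes nonempty = nonempty
... | no  empty    = contradiction (∣Empty∣≡0 empty) (λ ∣p∣≡0 → n≮0 (subst (0 <_) ∣p∣≡0 ∣p∣>0))

Empty-∅ : Empty (∅ {q})
Empty-∅ (_ , x∈∅) = ∉⊥ x∈∅

Nonempty-tail : ∀ {S : Subset q} → Nonempty (outside ∷ S) → Nonempty S
Nonempty-tail (zero  , ())
Nonempty-tail (suc i , there i∈S) = i , i∈S

Nonempty-∷⇒head : ∀ {t} {ρ : Subset s} → Nonempty (t ∷ ρ) → Empty ρ → t ≡ true
Nonempty-∷⇒head (zero  , here)        _      = refl
Nonempty-∷⇒head (suc i , there i∈ρ) empty  = contradiction (i , i∈ρ) empty

x∉p-x : ∀ (p : Subset n) x → x ∉ₛ p - x
x∉p-x (_ ∷ p) zero    ()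
x∉p-x (_ ∷ p) (suc x) (there x∈p-x) = x∉p-x p x x∈p-x

x∈p-y⇒x≢y : ∀ {p : Subset n} {x y} → x ∈ₛ p - y → x ≢ y
x∈p-y⇒x≢y {p = p} {x} x∈p-y refl = x∉p-x p x x∈p-y

x∈p─q⇒x∉q : ∀ (p q : Subset n) {x} → x ∈ₛ p ─ q → x ∉ₛ q
x∈p─q⇒x∉q (_ ∷ p) (_ ∷ q) (there x∈p─q) (there x∈q) = x∈p─q⇒x∉q p q x∈p─q x∈q

x∈p⇒suc∣p-x∣≡∣p∣ : ∀ {p : Subset n} {x} → x ∈ₛ p → suc ∣ p - x ∣ ≡ ∣ p ∣
x∈p⇒suc∣p-x∣≡∣p∣ {p = inside  ∷ p} here          = cong (suc ∘ ∣_∣) (p─⊥≡p p)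
x∈p⇒suc∣p-x∣≡∣p∣ {p = inside  ∷ p} (there x∈p) = cong suc (x∈p⇒suc∣p-x∣≡∣p∣ x∈p)
x∈p⇒suc∣p-x∣≡∣p∣ {p = outside ∷ p} (there x∈p) = x∈p⇒suc∣p-x∣≡∣p∣ x∈p

∣p∣≤suc∣p-x∣ : ∀ (p : Subset n) x → ∣ p ∣ ≤ suc ∣ p - x ∣
∣p∣≤suc∣p-x∣ p x with x ∈? p
... | yes x∈p = ≤-reflexive (sym (x∈p⇒suc∣p-x∣≡∣p∣ x∈p))
... | no  x∉p = ≤-trans (p⊆q⇒∣p∣≤∣q∣ p⊆p-x) (n≤1+n _)
  where
  p⊆p-x : p ⊆ p - x
  p⊆p-x y∈p = x∈p∧x≢y⇒x∈p-y y∈p λ { refl → x∉p y∈p }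

∣p∩q∣≤suc∣p∩q-y∣ : ∀ (p q : Subset n) y → ∣ p ∩ q ∣ ≤ suc ∣ p ∩ (q - y) ∣
∣p∩q∣≤suc∣p∩q-y∣ p q y = ≤-trans (∣p∣≤suc∣p-x∣ (p ∩ q) y) (s≤s (p⊆q⇒∣p∣≤∣q∣ p∩q-y⊆p∩[q-y]))
  where
  p∩q-y⊆p∩[q-y] : p ∩ q - y ⊆ p ∩ (q - y)
  p∩q-y⊆p∩[q-y] z∈ with x∈p∩q⁻ p q (p─q⊆p (p ∩ q) ⁅ y ⁆ z∈)
  ... | z∈p , z∈q = x∈p∩q⁺ (z∈p , x∈p∧x≢y⇒x∈p-y z∈q (x∈p-y⇒x≢y z∈))

[]≔outside≡- : ∀ (p : Subset n) x → p [ x ]≔ outside ≡ p - x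
[]≔outside≡- (_ ∷ p) zero    = cong (outside ∷_) (sym (p─⊥≡p p))
[]≔outside≡- (b ∷ p) (suc x) = cong (b ∷_) ([]≔outside≡- p x)

p⊆q∧∣q∣≤∣p∣⇒q⊆p : ∀ {p q : Subset n} → p ⊆ q → ∣ q ∣ ≤ ∣ p ∣ → q ⊆ p
p⊆q∧∣q∣≤∣p∣⇒q⊆p {p = p} p⊆q ∣q∣≤∣p∣ {x} x∈q with x ∈? p
... | yes x∈p = x∈p
... | no  x∉p = contradiction (p⊂q⇒∣p∣<∣q∣ (p⊆q , x , x∈q , x∉p)) (≤⇒≯ ∣q∣≤∣p∣)

∀-subset? : ∀ {P : Subset n → Set} → (∀ S → Dec (P S)) → Dec (∀ S → P S)
∀-subset? P? = map′
  (λ noCounterexample S → decidable-stable (P? S) (λ ¬PS → noCounterexample (S , ¬PS)))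
  (λ ∀P (S , ¬PS) → ¬PS (∀P S))
  (¬? (anySubset? (¬? ∘ P?)))

data Least {n} (P : Fin n → Set) : Maybe (Fin n) → Set where
  none : (∀ i → ¬ P i) → Least P nothing
  some : ∀ {i} → P i → (∀ {j} → P j → i ≤ᶠ j) → Least P (just i)

least : ∀ {P : Fin n → Set} → (∀ i → Dec (P i)) → ∃ (Least P)
least {zero}  P? = nothing , none λ ()
least {suc n} P? with P? zero
... | yes P0 = just zero , some P0 (λ _ → z≤n)
... | no ¬P0 with least (P? ∘ suc)
...   | nothing , none ¬P      = nothing , none λ { zero → ¬P0 ; (suc i) → ¬P i }
...   | just i  , some Pi min  = just (suc i) , some Pi λ { {zero} P0 → contradiction P0 ¬P0 ; {suc j} Pj → s≤s (min Pj) }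

Least-unique : ∀ {P Q : Fin n → Set} {x y} → (∀ {i} → P i → Q i) → (∀ {i} → Q i → P i) →
               Least P x → Least Q y → x ≡ y
Least-unique P⇒Q Q⇒P (none ¬P)     (none ¬Q)     = refl
Least-unique P⇒Q Q⇒P (none ¬P)     (some Qj _)   = contradiction (Q⇒P Qj) (¬P _)
Least-unique P⇒Q Q⇒P (some Pi _)   (none ¬Q)     = contradiction (P⇒Q Pi) (¬Q _)
Least-unique P⇒Q Q⇒P (some Pi min) (some Qj min′) = cong just (≤ᶠ-antisym (min (Q⇒P Qj)) (min′ (P⇒Q Pi)))

least-just : ∀ {P : Fin n → Set} (P? : ∀ i → Dec (P i)) {i} → P i →
             ∃ λ m → proj₁ (least P?) ≡ just m × P m × m ≤ᶠ i
least-just P? Pi with least P?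
... | nothing , none ¬P   = contradiction Pi (¬P _)
... | just m  , some Pm min = m , refl , Pm , min Pi

-- Edges, arcs and toggling

edge⇒∈ : ∀ (G : Graph q s) {i j} → Edge G i j → j ∈ₛ lookup G i
edge⇒∈ G {i} {j} = lookup⇒[]= j (lookup G i)

∈⇒edge : ∀ (G : Graph q s) {i j} → j ∈ₛ lookup G i → Edge G i j
∈⇒edge G = []=⇒lookup

infix 4 _⊆ᴳ_
record _⊆ᴳ_ (G H : Graph q s) : Set where
  constructor rows-⊆
  field
    row-⊆ : ∀ i → lookup G i ⊆ lookup H i

open _⊆ᴳ_

lookup-removeEdge : ∀ (G : Graph q s) i j → lookup (removeEdge G i j) i ≡ lookup G i - j
lookup-removeEdge G i j = trans (lookup∘updateAt i G) ([]≔outside≡- (lookup G i) j)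

lookup-removeEdge′ : ∀ (G : Graph q s) {i i′} j → i′ ≢ i → lookup (removeEdge G i j) i′ ≡ lookup G i′
lookup-removeEdge′ G {i} {i′} j i′≢i = lookup∘updateAt′ i′ i i′≢i G

removeEdge-⊆ᴳ : ∀ (G : Graph q s) i j → removeEdge G i j ⊆ᴳ G
removeEdge-⊆ᴳ G i j = rows-⊆ row⊆
  where
  row⊆ : ∀ i′ → lookup (removeEdge G i j) i′ ⊆ lookup G i′
  row⊆ i′ with i′ ≟ i
  ... | yes refl = λ x∈ → p─q⊆p _ _ (subst (_ ∈ₛ_) (lookup-removeEdge G i j) x∈)
  ... | no  i′≢i = λ x∈ → subst (_ ∈ₛ_) (lookup-removeEdge′ G j i′≢i) x∈

∈-removeEdge⁺ : ∀ (G : Graph q s) {i j i′ j′} → i′ ≢ i ⊎ j′ ≢ j →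
                j′ ∈ₛ lookup G i′ → j′ ∈ₛ lookup (removeEdge G i j) i′
∈-removeEdge⁺ G {i} {j} {i′} other j′∈ with i′ ≟ i | other
... | no  i′≢i | _          = subst (_ ∈ₛ_) (sym (lookup-removeEdge′ G j i′≢i)) j′∈
... | yes refl | inj₁ i≢i   = contradiction refl i≢i
... | yes refl | inj₂ j′≢j  = subst (_ ∈ₛ_) (sym (lookup-removeEdge G i j)) (x∈p∧x≢y⇒x∈p-y j′∈ j′≢j)

lookup-removeEdge-other : ∀ (G : Graph q s) {i j i′ j′} → i′ ≢ i ⊎ j′ ≢ j →
                          lookup (lookup (removeEdge G i j) i′) j′ ≡ lookup (lookup G i′) j′
lookup-removeEdge-other G {i} {j} {i′} {j′} other with i′ ≟ i | other
... | no  i′≢i | _         = cong (λ r → lookup r j′) (lookup-removeEdge′ G j i′≢i)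
... | yes refl | inj₁ i≢i  = contradiction refl i≢i
... | yes refl | inj₂ j′≢j =
  trans (cong (λ r → lookup r j′) (lookup∘updateAt i G)) (lookup∘update′ j′≢j (lookup G i) outside)

countᵇ-id≡∣∣ : ∀ (r : Subset s) → countᵇ id r ≡ ∣ r ∣
countᵇ-id≡∣∣ []          = refl
countᵇ-id≡∣∣ (true  ∷ r) = cong suc (countᵇ-id≡∣∣ r)
countᵇ-id≡∣∣ (false ∷ r) = countᵇ-id≡∣∣ r

numEdges-∷ : ∀ (r : Subset s) (G : Graph q s) → numEdges (r ∷ G) ≡ ∣ r ∣ + numEdges G
numEdges-∷ r G = cong (_+ numEdges G) (countᵇ-id≡∣∣ r)

numEdges-removeEdge : ∀ (G : Graph q s) {i j} → Edge G i j → suc (numEdges (removeEdge G i j)) ≡ numEdges G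
numEdges-removeEdge (r ∷ G) {zero} {j} e = begin
  suc (numEdges ((r [ j ]≔ outside) ∷ G))   ≡⟨ cong suc (numEdges-∷ (r [ j ]≔ outside) G) ⟩
  suc (∣ r [ j ]≔ outside ∣ + numEdges G)   ≡⟨ cong (λ p → suc (∣ p ∣ + numEdges G)) ([]≔outside≡- r j) ⟩
  suc ∣ r - j ∣ + numEdges G                ≡⟨ cong (_+ numEdges G) (x∈p⇒suc∣p-x∣≡∣p∣ (lookup⇒[]= j r e)) ⟩
  ∣ r ∣ + numEdges G                        ≡⟨ numEdges-∷ r G ⟨
  numEdges (r ∷ G)                          ∎
  where open ≡-Reasoning
numEdges-removeEdge (r ∷ G) {suc i} {j} e = begin
  suc (numEdges (r ∷ removeEdge G i j))     ≡⟨ cong suc (numEdges-∷ r (removeEdge G i j)) ⟩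
  suc (∣ r ∣ + numEdges (removeEdge G i j)) ≡⟨ +-suc _ _ ⟨
  ∣ r ∣ + suc (numEdges (removeEdge G i j)) ≡⟨ cong (∣ r ∣ +_) (numEdges-removeEdge G e) ⟩
  ∣ r ∣ + numEdges G                        ≡⟨ numEdges-∷ r G ⟨
  numEdges (r ∷ G)                          ∎
  where open ≡-Reasoning

Arc⇒numEdges : ∀ {σ τ : Graph q s} → Arc σ τ → suc (numEdges τ) ≡ numEdges σ
Arc⇒numEdges {σ = σ} (_ , _ , e , refl) = numEdges-removeEdge σ e

Arc-asym : ∀ {σ τ : Graph q s} → Arc σ τ → ¬ Arc τ σ
Arc-asym στ τσ = <-asym (≤-reflexive (Arc⇒numEdges στ)) (≤-reflexive (Arc⇒numEdges τσ))

Arc⇒⊆ᴳ : ∀ {σ τ : Graph q s} → Arc σ τ → τ ⊆ᴳ σ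
Arc⇒⊆ᴳ {σ = σ} (i , j , _ , refl) = removeEdge-⊆ᴳ σ i j

toggleEdge : Graph q s → Fin q → Fin s → Graph q s
toggleEdge G i j = updateAt G i (λ r → r [ j ]≔ not (lookup r j))

toggle-involutive : ∀ (r : Subset s) j → let r′ = r [ j ]≔ not (lookup r j) in r′ [ j ]≔ not (lookup r′ j) ≡ r
toggle-involutive (x ∷ r) zero    = cong (_∷ r) (not-involutive x)
toggle-involutive (x ∷ r) (suc j) = cong (x ∷_) (toggle-involutive r j)

toggleEdge-involutive : ∀ (G : Graph q s) i j → toggleEdge (toggleEdge G i j) i j ≡ G
toggleEdge-involutive G i j = trans (updateAt-updateAt i G) (updateAt-id-local i G (toggle-involutive (lookup G i) j))

toggleEdge-removeEdge : ∀ (G : Graph q s) {i j} → Edge G i j → toggleEdge G i j ≡ removeEdge G i j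
toggleEdge-removeEdge G {i} {j} e = updateAt-cong-local i G (cong (λ x → lookup G i [ j ]≔ not x) e)

lookup-toggleEdge : ∀ (G : Graph q s) i j → lookup (lookup (toggleEdge G i j) i) j ≡ not (lookup (lookup G i) j)
lookup-toggleEdge G i j = trans (cong (λ r → lookup r j) (lookup∘updateAt i G)) (lookup∘update j (lookup G i) _)

lookup-toggleEdge′ : ∀ (G : Graph q s) {i i′} j → i′ ≢ i → lookup (toggleEdge G i j) i′ ≡ lookup G i′
lookup-toggleEdge′ G {i} {i′} j i′≢i = lookup∘updateAt′ i′ i i′≢i G

toggleEdge-cases : ∀ (G : Graph q s) i j →
                   Edge G i j × toggleEdge G i j ≡ removeEdge G i j ⊎
                   Edge (toggleEdge G i j) i j × G ≡ removeEdge (toggleEdge G i j) i j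
toggleEdge-cases G i j with lookup (lookup G i) j in e
... | true  = inj₁ (refl , toggleEdge-removeEdge G e)
... | false = inj₂ (present , sym (begin
  removeEdge (toggleEdge G i j) i j  ≡⟨ toggleEdge-removeEdge (toggleEdge G i j) present ⟨
  toggleEdge (toggleEdge G i j) i j  ≡⟨ toggleEdge-involutive G i j ⟩
  G                                  ∎))
  where
  open ≡-Reasoning
  present : Edge (toggleEdge G i j) i j
  present = trans (lookup-toggleEdge G i j) (cong not e)

-- Neighbourhoods and surplus

N : Graph q s → Subset q → Subset s
N []      []            = ∅
N (r ∷ G) (inside  ∷ S) = r ∪ N G S
N (r ∷ G) (outside ∷ S) = N G S

∈N⁺ : ∀ (G : Graph q s) {S i j} → i ∈ₛ S → j ∈ₛ lookup G i → j ∈ₛ N G S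
∈N⁺ (r ∷ G)                 here        j∈r = x∈p∪q⁺ (inj₁ j∈r)
∈N⁺ (r ∷ G) {inside  ∷ S} (there i∈S) j∈  = x∈p∪q⁺ (inj₂ (∈N⁺ G i∈S j∈))
∈N⁺ (r ∷ G) {outside ∷ S} (there i∈S) j∈  = ∈N⁺ G i∈S j∈

∈N⁻ : ∀ (G : Graph q s) S {j} → j ∈ₛ N G S → ∃ λ i → i ∈ₛ S × j ∈ₛ lookup G i
∈N⁻ []      []            j∈ = contradiction j∈ ∉⊥
∈N⁻ (r ∷ G) (inside  ∷ S) j∈ with x∈p∪q⁻ r (N G S) j∈
... | inj₁ j∈r = zero , here , j∈r
... | inj₂ j∈N = Product.map suc (Product.map₁ there) (∈N⁻ G S j∈N)
∈N⁻ (r ∷ G) (outside ∷ S) j∈ = Product.map suc (Product.map₁ there) (∈N⁻ G S j∈)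

N-monoʳ : ∀ (G : Graph q s) {S T} → S ⊆ T → N G S ⊆ N G T
N-monoʳ G {S} S⊆T j∈ with ∈N⁻ G S j∈
... | i , i∈S , j∈Gi = ∈N⁺ G (S⊆T i∈S) j∈Gi

N-monoˡ : ∀ {G H : Graph q s} {S} → G ⊆ᴳ H → N G S ⊆ N H S
N-monoˡ {G = G} {H} {S} G⊆H j∈ with ∈N⁻ G S j∈
... | i , i∈S , j∈Gi = ∈N⁺ H i∈S (row-⊆ G⊆H i j∈Gi)

N-cong : ∀ (G H : Graph q s) S → (∀ {i} → i ∈ₛ S → lookup G i ≡ lookup H i) → N G S ≡ N H S
N-cong []      []       []            rows≡ = refl
N-cong (r ∷ G) (r′ ∷ H) (inside  ∷ S) rows≡ = cong₂ _∪_ (rows≡ here) (N-cong G H S (rows≡ ∘ there))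
N-cong (r ∷ G) (r′ ∷ H) (outside ∷ S) rows≡ = N-cong G H S (rows≡ ∘ there)

N-updateAt : ∀ (G : Graph q s) {S i} f → i ∉ₛ S → N (updateAt G i f) S ≡ N G S
N-updateAt G {S} {i} f i∉S = N-cong (updateAt G i f) G S λ {k} k∈S → lookup∘updateAt′ k i (λ { refl → i∉S k∈S }) G

Surplus : Graph q s → Set
Surplus {q} G = ∀ (S : Subset q) → Nonempty S → ∣ S ∣ < ∣ N G S ∣

-- Opaque, so that `kind` below can branch on `does (surplus? G)` without unfolding the search.
opaque
  surplus? : ∀ (G : Graph q s) → Dec (Surplus G)
  surplus? G = ∀-subset? λ S → nonempty? S →-dec (∣ S ∣ <? ∣ N G S ∣)

Surplus-mono : ∀ {G H : Graph q s} → G ⊆ᴳ H → Surplus G → Surplus H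
Surplus-mono G⊆H surplus S nonempty = <-≤-trans (surplus S nonempty) (p⊆q⇒∣p∣≤∣q∣ (N-monoˡ G⊆H))

Surplus⇒q<s : ∀ (G : Graph (suc q) s) → Surplus G → suc q < s
Surplus⇒q<s {q} G surplus =
  ≤-trans (subst (_< ∣ N G ⊤ₛ ∣) (∣⊤∣≡n (suc q)) (surplus ⊤ₛ (zero , ∈⊤))) (∣p∣≤n (N G ⊤ₛ))

¬Surplus⇒violator : ∀ (G : Graph q s) → ¬ Surplus G → ∃ λ S → Nonempty S × ∣ N G S ∣ ≤ ∣ S ∣
¬Surplus⇒violator G ¬surplus with anySubset? (λ S → nonempty? S ×-dec ∣ N G S ∣ ≤? ∣ S ∣)
... | yes violator = violator
... | no  noViolator = contradiction (λ S nonempty → ≰⇒> (λ small → noViolator (S , nonempty , small))) ¬surplus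

Surplus⇒∣S∣<∣NS∪⁅w⁆∣ : ∀ (G : Graph q s) → Surplus G → ∀ S w → ∣ S ∣ < ∣ N G S ∪ ⁅ w ⁆ ∣
Surplus⇒∣S∣<∣NS∪⁅w⁆∣ G surplus S w with nonempty? S
... | yes nonempty = <-≤-trans (surplus S nonempty) (∣p∣≤∣p∪q∣ (N G S) ⁅ w ⁆)
... | no  empty    = begin-strict
  ∣ S ∣              ≡⟨ ∣Empty∣≡0 empty ⟩
  0                  <⟨ s≤s z≤n ⟩
  1                  ≡⟨ ∣⁅x⁆∣≡1 w ⟨
  ∣ ⁅ w ⁆ ∣          ≤⟨ ∣q∣≤∣p∪q∣ (N G S) ⁅ w ⁆ ⟩
  ∣ N G S ∪ ⁅ w ⁆ ∣  ∎
  where open ≤-Reasoning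

-- Submodularity: |N′(T)| + |N(X)| ≥ |N(T ∪ X)| + |N(T ∩ X) ∪ {w}|, where N′ is taken after the removal.
Surplus-removeEdge : ∀ (G : Graph q s) {X i z w} → Surplus G → ∣ N G X ∣ ≡ suc ∣ X ∣ → i ∉ₛ X →
                     z ∈ₛ N G X → w ∈ₛ N G X → w ≢ z → w ∈ₛ lookup G i → Surplus (removeEdge G i z)
Surplus-removeEdge G {X} {i} {z} {w} surplus tight i∉X z∈NX w∈NX w≢z w∈Gi T nonempty with i ∈? T
... | no  i∉T = subst (λ N′ → ∣ T ∣ < ∣ N′ ∣) (sym (N-updateAt G _ i∉T)) (surplus T nonempty)
... | yes i∈T = +-cancelʳ-≤ (suc ∣ X ∣) (suc ∣ T ∣) (∣ A ∣) (begin
  suc ∣ T ∣ + suc ∣ X ∣           ≡⟨ cong suc (+-suc ∣ T ∣ ∣ X ∣) ⟩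
  suc (suc (∣ T ∣ + ∣ X ∣))       ≡⟨ cong (λ n → suc (suc n)) (∣p∪q∣+∣p∩q∣≡∣p∣+∣q∣ T X) ⟨
  suc (suc (∣ U ∣ + ∣ I ∣))       ≡⟨ cong suc (+-suc ∣ U ∣ ∣ I ∣) ⟨
  suc ∣ U ∣ + suc ∣ I ∣           ≤⟨ +-mono-≤ (surplus U nonemptyU) (Surplus⇒∣S∣<∣NS∪⁅w⁆∣ G surplus I w) ⟩
  ∣ N G U ∣ + ∣ N G I ∪ ⁅ w ⁆ ∣   ≤⟨ +-mono-≤ (p⊆q⇒∣p∣≤∣q∣ NU⊆A∪B) (p⊆q⇒∣p∣≤∣q∣ NI∪w⊆A∩B) ⟩
  ∣ A ∪ B ∣ + ∣ A ∩ B ∣           ≡⟨ ∣p∪q∣+∣p∩q∣≡∣p∣+∣q∣ A B ⟩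
  ∣ A ∣ + ∣ B ∣                   ≡⟨ cong (∣ A ∣ +_) tight ⟩
  ∣ A ∣ + suc ∣ X ∣               ∎)
  where
  open ≤-Reasoning
  A = N (removeEdge G i z) T
  B = N G X
  U = T ∪ X
  I = T ∩ X

  nonemptyU : Nonempty U
  nonemptyU = proj₁ nonempty , x∈p∪q⁺ (inj₁ (proj₂ nonempty))

  survives : ∀ {k y} → k ∈ₛ T → y ∈ₛ lookup G k → k ≢ i ⊎ y ≢ z → y ∈ₛ A
  survives k∈T y∈Gk other = ∈N⁺ (removeEdge G i z) k∈T (∈-removeEdge⁺ G other y∈Gk)

  NU⊆A∪B : N G U ⊆ A ∪ B
  NU⊆A∪B {y} y∈NU with ∈N⁻ G U y∈NU
  ... | k , k∈U , y∈Gk with k ∈? X | x∈p∪q⁻ T X k∈U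
  ...   | yes k∈X | _        = x∈p∪q⁺ (inj₂ (∈N⁺ G k∈X y∈Gk))
  ...   | no  k∉X | inj₂ k∈X = contradiction k∈X k∉X
  ...   | no  _   | inj₁ k∈T with k ≟ i | y ≟ z
  ...     | yes refl | yes refl = x∈p∪q⁺ (inj₂ z∈NX)
  ...     | no  k≢i  | _        = x∈p∪q⁺ (inj₁ (survives k∈T y∈Gk (inj₁ k≢i)))
  ...     | yes refl | no  y≢z  = x∈p∪q⁺ (inj₁ (survives k∈T y∈Gk (inj₂ y≢z)))

  NI∪w⊆A∩B : N G I ∪ ⁅ w ⁆ ⊆ A ∩ B
  NI∪w⊆A∩B {y} y∈ with x∈p∪q⁻ (N G I) ⁅ w ⁆ y∈
  ... | inj₂ y∈⁅w⁆ rewrite x∈⁅y⁆⇒x≡y w y∈⁅w⁆ = x∈p∩q⁺ (survives i∈T w∈Gi (inj₂ w≢z) , w∈NX)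
  ... | inj₁ y∈NI with ∈N⁻ G I y∈NI
  ...   | k , k∈I , y∈Gk with x∈p∩q⁻ T X k∈I
  ...     | k∈T , k∈X = x∈p∩q⁺ (survives k∈T y∈Gk (inj₁ λ { refl → i∉X k∈X }) , ∈N⁺ G k∈X y∈Gk)

-- Hall's theorem

HallCondition : Graph q s → Subset q → Subset s → Set
HallCondition G A B = ∀ {S} → S ⊆ A → ∣ S ∣ ≤ ∣ N G S ∩ B ∣

record Saturating (G : Graph q s) (A : Subset q) (B : Subset s) : Set where
  field
    partner           : ∀ {i} → i ∈ₛ A → Fin s
    partner∈B         : ∀ {i} (i∈A : i ∈ₛ A) → partner i∈A ∈ₛ B
    partner-adjacent  : ∀ {i} (i∈A : i ∈ₛ A) → partner i∈A ∈ₛ lookup G i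
    partner-injective : ∀ {i j} (i∈A : i ∈ₛ A) (j∈A : j ∈ₛ A) → partner i∈A ≡ partner j∈A → i ≡ j

saturating-empty : ∀ {G : Graph q s} {A B} → Empty A → Saturating G A B
saturating-empty empty = record
  { partner           = λ i∈A → contradiction (_ , i∈A) empty
  ; partner∈B         = λ i∈A → contradiction (_ , i∈A) empty
  ; partner-adjacent  = λ i∈A → contradiction (_ , i∈A) empty
  ; partner-injective = λ i∈A _ _ → contradiction (_ , i∈A) empty
  }

saturating-edge : ∀ {G : Graph q s} {x y} → y ∈ₛ lookup G x → Saturating G ⁅ x ⁆ ⁅ y ⁆
saturating-edge {G = G} {x} {y} y∈Gx = record
  { partner           = λ _ → y
  ; partner∈B         = λ _ → x∈⁅x⁆ y
  ; partner-adjacent  = λ i∈⁅x⁆ → subst (λ i → y ∈ₛ lookup G i) (sym (x∈⁅y⁆⇒x≡y x i∈⁅x⁆)) y∈Gx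
  ; partner-injective = λ i∈⁅x⁆ j∈⁅x⁆ _ → trans (x∈⁅y⁆⇒x≡y x i∈⁅x⁆) (sym (x∈⁅y⁆⇒x≡y x j∈⁅x⁆))
  }

saturating-mono : ∀ {G : Graph q s} {A A′ B B′} → A′ ⊆ A → B ⊆ B′ → Saturating G A B → Saturating G A′ B′
saturating-mono A′⊆A B⊆B′ M = record
  { partner           = λ i∈A′ → partner (A′⊆A i∈A′)
  ; partner∈B         = λ i∈A′ → B⊆B′ (partner∈B (A′⊆A i∈A′))
  ; partner-adjacent  = λ i∈A′ → partner-adjacent (A′⊆A i∈A′)
  ; partner-injective = λ i∈A′ j∈A′ → partner-injective (A′⊆A i∈A′) (A′⊆A j∈A′)
  }
  where open Saturating M

saturating-∪ : ∀ {G : Graph q s} {A₁ A₂ B₁ B₂} → Empty (B₁ ∩ B₂) →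
               Saturating G A₁ B₁ → Saturating G A₂ B₂ → Saturating G (A₁ ∪ A₂) (B₁ ∪ B₂)
saturating-∪ {s = s} {G = G} {A₁} {A₂} {B₁} {B₂} disjoint M₁ M₂ = record
  { partner           = λ i∈ → partnerOn (x∈p∪q⁻ A₁ A₂ i∈)
  ; partner∈B         = λ i∈ → partnerOn∈B (x∈p∪q⁻ A₁ A₂ i∈)
  ; partner-adjacent  = λ i∈ → partnerOn-adjacent (x∈p∪q⁻ A₁ A₂ i∈)
  ; partner-injective = λ i∈ j∈ → partnerOn-injective (x∈p∪q⁻ A₁ A₂ i∈) (x∈p∪q⁻ A₁ A₂ j∈)
  }
  where
  module M₁ = Saturating M₁
  module M₂ = Saturating M₂

  partnerOn : ∀ {i} → i ∈ₛ A₁ ⊎ i ∈ₛ A₂ → Fin s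
  partnerOn (inj₁ i∈A₁) = M₁.partner i∈A₁
  partnerOn (inj₂ i∈A₂) = M₂.partner i∈A₂

  partnerOn∈B : ∀ {i} (side : i ∈ₛ A₁ ⊎ i ∈ₛ A₂) → partnerOn side ∈ₛ B₁ ∪ B₂
  partnerOn∈B (inj₁ i∈A₁) = x∈p∪q⁺ (inj₁ (M₁.partner∈B i∈A₁))
  partnerOn∈B (inj₂ i∈A₂) = x∈p∪q⁺ (inj₂ (M₂.partner∈B i∈A₂))

  partnerOn-adjacent : ∀ {i} (side : i ∈ₛ A₁ ⊎ i ∈ₛ A₂) → partnerOn side ∈ₛ lookup G i
  partnerOn-adjacent (inj₁ i∈A₁) = M₁.partner-adjacent i∈A₁
  partnerOn-adjacent (inj₂ i∈A₂) = M₂.partner-adjacent i∈A₂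

  partnerOn-injective : ∀ {i j} (sideᵢ : i ∈ₛ A₁ ⊎ i ∈ₛ A₂) (sideⱼ : j ∈ₛ A₁ ⊎ j ∈ₛ A₂) →
                        partnerOn sideᵢ ≡ partnerOn sideⱼ → i ≡ j
  partnerOn-injective (inj₁ i∈A₁) (inj₁ j∈A₁) eq = M₁.partner-injective i∈A₁ j∈A₁ eq
  partnerOn-injective (inj₂ i∈A₂) (inj₂ j∈A₂) eq = M₂.partner-injective i∈A₂ j∈A₂ eq
  partnerOn-injective (inj₁ i∈A₁) (inj₂ j∈A₂) eq =
    contradiction (_ , x∈p∩q⁺ (M₁.partner∈B i∈A₁ , subst (_∈ₛ B₂) (sym eq) (M₂.partner∈B j∈A₂))) disjoint
  partnerOn-injective (inj₂ i∈A₂) (inj₁ j∈A₁) eq =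
    contradiction (_ , x∈p∩q⁺ (subst (_∈ₛ B₁) (sym eq) (M₁.partner∈B j∈A₁) , M₂.partner∈B i∈A₂)) disjoint

saturating-glue : ∀ {G : Graph q s} {A B S T R} → T ⊆ R → T ⊆ B →
                  Saturating G S T → Saturating G (A ─ S) (B ─ R) → Saturating G A B
saturating-glue {A = A} {B} {S} {T} {R} T⊆R T⊆B M₁ M₂ =
  saturating-mono A⊆S∪A─S T∪B─R⊆B (saturating-∪ disjoint M₁ M₂)
  where
  A⊆S∪A─S : A ⊆ S ∪ (A ─ S)
  A⊆S∪A─S {i} i∈A with i ∈? S
  ... | yes i∈S = x∈p∪q⁺ (inj₁ i∈S)
  ... | no  i∉S = x∈p∪q⁺ (inj₂ (x∈p∧x∉q⇒x∈p─q i∈A i∉S))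

  T∪B─R⊆B : T ∪ (B ─ R) ⊆ B
  T∪B─R⊆B y∈ with x∈p∪q⁻ T (B ─ R) y∈
  ... | inj₁ y∈T   = T⊆B y∈T
  ... | inj₂ y∈B─R = p─q⊆p B R y∈B─R

  disjoint : Empty (T ∩ (B ─ R))
  disjoint (y , y∈) with x∈p∩q⁻ T (B ─ R) y∈
  ... | y∈T , y∈B─R = x∈p─q⇒x∉q B R y∈B─R (T⊆R y∈T)

Tight : Graph q s → Subset q → Subset s → Subset q → Set
Tight G A B S = Nonempty S × S ⊂ A × ∣ N G S ∩ B ∣ ≤ ∣ S ∣

tight? : ∀ (G : Graph q s) A B S → Dec (Tight G A B S)
tight? G A B S = nonempty? S ×-dec S ⊂? A ×-dec ∣ N G S ∩ B ∣ ≤? ∣ S ∣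

hall-inside : ∀ {G : Graph q s} {A B S} → HallCondition G A B → S ⊆ A → HallCondition G S (N G S ∩ B)
hall-inside {G = G} {A} {B} {S} hallAB S⊆A {T} T⊆S =
  ≤-trans (hallAB (⊆-trans T⊆S S⊆A)) (p⊆q⇒∣p∣≤∣q∣ NT∩B⊆NT∩NS∩B)
  where
  NT∩B⊆NT∩NS∩B : N G T ∩ B ⊆ N G T ∩ (N G S ∩ B)
  NT∩B⊆NT∩NS∩B y∈ with x∈p∩q⁻ (N G T) B y∈
  ... | y∈NT , y∈B = x∈p∩q⁺ (y∈NT , x∈p∩q⁺ (N-monoʳ G T⊆S y∈NT , y∈B))

hall-outside : ∀ {G : Graph q s} {A B S} → HallCondition G A B → S ⊆ A → ∣ N G S ∩ B ∣ ≤ ∣ S ∣ →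
               HallCondition G (A ─ S) (B ─ N G S)
hall-outside {G = G} {A} {B} {S} hallAB S⊆A NS-small {T} T⊆A─S = +-cancelʳ-≤ (∣ S ∣) (∣ T ∣) (∣ NT′ ∣) (begin
  ∣ T ∣ + ∣ S ∣            ≡⟨ ∣p∪q∣≡∣p∣+∣q∣ T S T∩S-empty ⟨
  ∣ T ∪ S ∣                ≤⟨ hallAB T∪S⊆A ⟩
  ∣ N G (T ∪ S) ∩ B ∣      ≤⟨ p⊆q⇒∣p∣≤∣q∣ cover ⟩
  ∣ NT′ ∪ (N G S ∩ B) ∣    ≤⟨ ∣p∪q∣≤∣p∣+∣q∣ NT′ (N G S ∩ B) ⟩
  ∣ NT′ ∣ + ∣ N G S ∩ B ∣  ≤⟨ +-monoʳ-≤ (∣ NT′ ∣) NS-small ⟩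
  ∣ NT′ ∣ + ∣ S ∣          ∎)
  where
  open ≤-Reasoning
  NT′ = N G T ∩ (B ─ N G S)

  T∩S-empty : Empty (T ∩ S)
  T∩S-empty (x , x∈T∩S) with x∈p∩q⁻ T S x∈T∩S
  ... | x∈T , x∈S = x∈p─q⇒x∉q A S (T⊆A─S x∈T) x∈S

  T∪S⊆A : T ∪ S ⊆ A
  T∪S⊆A x∈ with x∈p∪q⁻ T S x∈
  ... | inj₁ x∈T = p─q⊆p A S (T⊆A─S x∈T)
  ... | inj₂ x∈S = S⊆A x∈S

  cover : N G (T ∪ S) ∩ B ⊆ NT′ ∪ (N G S ∩ B)
  cover {y} y∈ with x∈p∩q⁻ (N G (T ∪ S)) B y∈
  ... | y∈N , y∈B with y ∈? N G S
  ...   | yes y∈NS = x∈p∪q⁺ (inj₂ (x∈p∩q⁺ (y∈NS , y∈B)))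
  ...   | no  y∉NS with ∈N⁻ G (T ∪ S) y∈N
  ...     | i , i∈T∪S , y∈Gi with x∈p∪q⁻ T S i∈T∪S
  ...       | inj₁ i∈T = x∈p∪q⁺ (inj₁ (x∈p∩q⁺ (∈N⁺ G i∈T y∈Gi , x∈p∧x∉q⇒x∈p─q y∈B y∉NS)))
  ...       | inj₂ i∈S = contradiction (∈N⁺ G i∈S y∈Gi) y∉NS

hall-remove : ∀ {G : Graph q s} {A B x} y → HallCondition G A B → (∀ S → ¬ Tight G A B S) → x ∈ₛ A →
              HallCondition G (A - x) (B - y)
hall-remove {G = G} {A} {B} {x} y hallAB noTight x∈A {T} T⊆A-x with nonempty? T
... | no  empty    = ≤-trans (≤-reflexive (∣Empty∣≡0 empty)) z≤n
... | yes nonempty = s≤s⁻¹ (begin-strict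
  ∣ T ∣                    <⟨ ≰⇒> (λ notLarger → noTight T (nonempty , T⊂A , notLarger)) ⟩
  ∣ N G T ∩ B ∣            ≤⟨ ∣p∩q∣≤suc∣p∩q-y∣ (N G T) B y ⟩
  suc ∣ N G T ∩ (B - y) ∣  ∎)
  where
  open ≤-Reasoning
  T⊂A : T ⊂ A
  T⊂A = (λ z∈T → p─q⊆p A ⁅ x ⁆ (T⊆A-x z∈T)) , x , x∈A , λ x∈T → x∉p-x A x (T⊆A-x x∈T)

hall-neighbour : ∀ {G : Graph q s} {A B x} → HallCondition G A B → x ∈ₛ A → ∃ λ y → y ∈ₛ B × y ∈ₛ lookup G x
hall-neighbour {G = G} {A} {B} {x} hallAB x∈A
  with ∣p∣>0⇒Nonempty (subst (_≤ ∣ N G ⁅ x ⁆ ∩ B ∣) (∣⁅x⁆∣≡1 x) (hallAB (x∈p⇒⁅x⁆⊆p x∈A)))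
... | y , y∈ with x∈p∩q⁻ (N G ⁅ x ⁆) B y∈
...   | y∈N , y∈B with ∈N⁻ G ⁅ x ⁆ y∈N
...     | i , i∈⁅x⁆ , y∈Gi = y , y∈B , subst (λ i → y ∈ₛ lookup G i) (x∈⁅y⁆⇒x≡y x i∈⁅x⁆) y∈Gi

-- Halmos–Vaughan: split along a tight set if there is one, and otherwise match x along any edge.
hall-bounded : ∀ (G : Graph q s) n {A B} → ∣ A ∣ ≤ n → HallCondition G A B → Saturating G A B
hall-bounded G n {A} {B} ∣A∣≤n hallAB with nonempty? A | anySubset? (tight? G A B)
... | no empty | _ = saturating-empty empty
hall-bounded G zero    ∣A∣≤0 hallAB | yes nonempty | _ = contradiction ∣A∣≤0 (<⇒≱ (Nonempty⇒∣p∣>0 nonempty))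
hall-bounded G (suc n) {A} {B} ∣A∣≤1+n hallAB | yes _ | yes (S , (z , z∈S) , S⊂A@(S⊆A , _) , NS-small) =
  saturating-glue (p∩q⊆p (N G S) B) (p∩q⊆q (N G S) B)
    (hall-bounded G n (s≤s⁻¹ (≤-trans (p⊂q⇒∣p∣<∣q∣ S⊂A) ∣A∣≤1+n)) (hall-inside {G = G} {B = B} hallAB S⊆A))
    (hall-bounded G n (s≤s⁻¹ (≤-trans (p∩q≢∅⇒∣p─q∣<∣p∣ A S (z , x∈p∩q⁺ (S⊆A z∈S , z∈S))) ∣A∣≤1+n))
      (hall-outside {G = G} {B = B} hallAB S⊆A NS-small))
hall-bounded G (suc n) {A} {B} ∣A∣≤1+n hallAB | yes (x , x∈A) | no noTight with hall-neighbour {G = G} {B = B} hallAB x∈A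
... | y , y∈B , y∈Gx =
  saturating-glue ⊆-refl (x∈p⇒⁅x⁆⊆p y∈B) (saturating-edge y∈Gx)
    (hall-bounded G n (s≤s⁻¹ (≤-trans (x∈p⇒∣p-x∣<∣p∣ x∈A) ∣A∣≤1+n))
      (hall-remove {G = G} {B = B} y hallAB (λ S tight → noTight (S , tight)) x∈A))

hall : ∀ (G : Graph q s) {A B} → HallCondition G A B → Saturating G A B
hall G = hall-bounded G _ ≤-refl

-- Surplus graphs are exactly the q-factor-critical ones

surplus⇒hall : ∀ (G : Graph q s) → Surplus G → ∀ y → HallCondition G ⊤ₛ (⊤ₛ - y)
surplus⇒hall G surplus y {S} _ with nonempty? S
... | no  empty    = ≤-trans (≤-reflexive (∣Empty∣≡0 empty)) z≤n
... | yes nonempty = s≤s⁻¹ (begin-strict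
  ∣ S ∣                     <⟨ surplus S nonempty ⟩
  ∣ N G S ∣                 ≡⟨ cong ∣_∣ (∩-identityʳ (N G S)) ⟨
  ∣ N G S ∩ ⊤ₛ ∣            ≤⟨ ∣p∩q∣≤suc∣p∩q-y∣ (N G S) ⊤ₛ y ⟩
  suc ∣ N G S ∩ (⊤ₛ - y) ∣  ∎)
  where open ≤-Reasoning

saturating⇒matching : ∀ {G : Graph q s} y → Saturating G ⊤ₛ (⊤ₛ - y) →
                      Σ (Matching (deleteY G y)) λ m → length (Matching.edges m) ≡ q
saturating⇒matching {q = q} {s} {G = G} y M =
  record { edges = tabulate edge ; inGraph = All.tabulate⁺ edge-avoids-y ; disjoint = AllPairs.tabulate⁺ disjoint } ,
  length-tabulate edge
  where
  open Saturating M
  edge : Fin q → Fin q × Fin s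
  edge i = i , partner ∈⊤

  edge-avoids-y : ∀ i → deleteY G y (proj₁ (edge i)) (proj₂ (edge i))
  edge-avoids-y i = ∈⇒edge G (partner-adjacent ∈⊤) , x∈p-y⇒x≢y (partner∈B ∈⊤)

  disjoint : ∀ {i j} → i ≢ j → Disjoint (edge i) (edge j)
  disjoint i≢j = i≢j , λ same-partner → i≢j (partner-injective ∈⊤ ∈⊤ same-partner)

surplus⇒factorCritical : ∀ (G : Graph q s) → q < s → Surplus G → FactorCritical G
surplus⇒factorCritical G q<s surplus =
  q<s , λ y → saturating⇒matching y (hall G (surplus⇒hall G surplus y))

fromList : List (Fin n) → Subset n
fromList = List.foldr (λ x p → ⁅ x ⁆ ∪ p) ∅

∈fromList⁺ : ∀ {x : Fin n} {xs} → x ∈ xs → x ∈ₛ fromList xs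
∈fromList⁺ (here refl) = x∈p∪q⁺ (inj₁ (x∈⁅x⁆ _))
∈fromList⁺ (there x∈)  = x∈p∪q⁺ (inj₂ (∈fromList⁺ x∈))

∈fromList⁻ : ∀ {x : Fin n} xs → x ∈ₛ fromList xs → x ∈ xs
∈fromList⁻ []       x∈ = contradiction x∈ ∉⊥
∈fromList⁻ (y ∷ xs) x∈ with x∈p∪q⁻ ⁅ y ⁆ (fromList xs) x∈
... | inj₁ x∈⁅y⁆ = here (x∈⁅y⁆⇒x≡y y x∈⁅y⁆)
... | inj₂ x∈xs  = there (∈fromList⁻ xs x∈xs)

∣fromList∣≡length : ∀ {xs : List (Fin n)} → Unique xs → ∣ fromList xs ∣ ≡ length xs
∣fromList∣≡length {n} []                     = ∣⊥∣≡0 n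
∣fromList∣≡length {xs = x ∷ xs} (x∉xs ∷ unique) =
  trans (∣p∪q∣≡∣p∣+∣q∣ ⁅ x ⁆ (fromList xs) disjoint) (cong₂ _+_ (∣⁅x⁆∣≡1 x) (∣fromList∣≡length unique))
  where
  disjoint : Empty (⁅ x ⁆ ∩ fromList xs)
  disjoint (z , z∈) with x∈p∩q⁻ ⁅ x ⁆ (fromList xs) z∈
  ... | z∈⁅x⁆ , z∈xs = All.lookup x∉xs (∈fromList⁻ xs z∈xs) (sym (x∈⁅y⁆⇒x≡y x z∈⁅x⁆))

lefts : List (Fin q × Fin s) → Subset q
lefts es = fromList (List.map proj₁ es)

rights : List (Fin q × Fin s) → Subset s
rights es = fromList (List.map proj₂ es)

∣lefts∣≡length : ∀ {es : List (Fin q × Fin s)} → AllPairs Disjoint es → ∣ lefts es ∣ ≡ length es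
∣lefts∣≡length {es = es} disjoint =
  trans (∣fromList∣≡length (AllPairs.map⁺ (AllPairs.map proj₁ disjoint))) (length-map proj₁ es)

∣rights∣≡length : ∀ {es : List (Fin q × Fin s)} → AllPairs Disjoint es → ∣ rights es ∣ ≡ length es
∣rights∣≡length {es = es} disjoint =
  trans (∣fromList∣≡length (AllPairs.map⁺ (AllPairs.map proj₂ disjoint))) (length-map proj₂ es)

Matching-covers : ∀ {E : Fin q → Fin s → Set} (m : Matching E) → length (Matching.edges m) ≡ q →
                  ∀ i → i ∈ List.map proj₁ (Matching.edges m)
Matching-covers m length≡q i =
  ∈fromList⁻ _ (subst (i ∈ₛ_) (sym (∣p∣≡n⇒p≡⊤ (trans (∣lefts∣≡length (Matching.disjoint m)) length≡q))) ∈⊤)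

matched-neighbours : ∀ (G : Graph q s) {y} (m : Matching (deleteY G y)) → length (Matching.edges m) ≡ q →
                     ∀ S → ∃ λ Y → Y ⊆ N G S × y ∉ₛ Y × ∣ S ∣ ≤ ∣ Y ∣
matched-neighbours {q = q} {s} G {y} m length≡q S = rights edgesS , Y⊆NS , y∉Y , ∣S∣≤∣Y∣
  where
  open Matching m
  inS? : ∀ (e : Fin q × Fin s) → Dec (proj₁ e ∈ₛ S)
  inS? e = proj₁ e ∈? S

  edgesS = filter inS? edges

  disjointS : AllPairs Disjoint edgesS
  disjointS = AllPairs.filter⁺ inS? disjoint

  Y⊆NS : rights edgesS ⊆ N G S
  Y⊆NS z∈ with ∈-map⁻ proj₂ (∈fromList⁻ _ z∈)
  ... | e , e∈S , refl with ∈-filter⁻ inS? e∈S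
  ...   | e∈ , i∈S = ∈N⁺ G i∈S (edge⇒∈ G (proj₁ (All.lookup inGraph e∈)))

  y∉Y : y ∉ₛ rights edgesS
  y∉Y y∈ with ∈-map⁻ proj₂ (∈fromList⁻ _ y∈)
  ... | e , e∈S , y≡ = proj₂ (All.lookup inGraph (proj₁ (∈-filter⁻ inS? e∈S))) (sym y≡)

  S⊆lefts : S ⊆ lefts edgesS
  S⊆lefts {i} i∈S with ∈-map⁻ proj₁ (Matching-covers m length≡q i)
  ... | e , e∈ , refl = ∈fromList⁺ (∈-map⁺ proj₁ (∈-filter⁺ inS? e∈ i∈S))

  ∣S∣≤∣Y∣ : ∣ S ∣ ≤ ∣ rights edgesS ∣
  ∣S∣≤∣Y∣ = ≤-trans (p⊆q⇒∣p∣≤∣q∣ S⊆lefts)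
                    (≤-reflexive (trans (∣lefts∣≡length disjointS) (sym (∣rights∣≡length disjointS))))

factorCritical⇒surplus : ∀ (G : Graph q s) → FactorCritical G → Surplus G
factorCritical⇒surplus {q = q} {s} G (q<s , avoiding) S nonempty@(x , _) =
  avoid-neighbour (neighboursAvoiding y)
  where
  neighboursAvoiding : ∀ y → ∃ λ Y → Y ⊆ N G S × y ∉ₛ Y × ∣ S ∣ ≤ ∣ Y ∣
  neighboursAvoiding y = matched-neighbours G (proj₁ (avoiding y)) (proj₂ (avoiding y)) S

  some-neighbour : ∃ λ y → y ∈ₛ N G S
  some-neighbour with neighboursAvoiding (inject≤ x (<⇒≤ q<s))
  ... | Y , Y⊆NS , _ , ∣S∣≤∣Y∣ =
    Product.map₂ Y⊆NS (∣p∣>0⇒Nonempty (<-≤-trans (Nonempty⇒∣p∣>0 nonempty) ∣S∣≤∣Y∣))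

  y = proj₁ some-neighbour

  avoid-neighbour : (∃ λ Y → Y ⊆ N G S × y ∉ₛ Y × ∣ S ∣ ≤ ∣ Y ∣) → ∣ S ∣ < ∣ N G S ∣
  avoid-neighbour (Y , Y⊆NS , y∉Y , ∣S∣≤∣Y∣) = begin-strict
    ∣ S ∣          ≤⟨ ∣S∣≤∣Y∣ ⟩
    ∣ Y ∣          ≤⟨ p⊆q⇒∣p∣≤∣q∣ Y⊆NS-y ⟩
    ∣ N G S - y ∣  <⟨ x∈p⇒∣p-x∣<∣p∣ (proj₂ some-neighbour) ⟩
    ∣ N G S ∣      ∎
    where
    open ≤-Reasoning
    Y⊆NS-y : Y ⊆ N G S - y
    Y⊆NS-y z∈Y = x∈p∧x≢y⇒x∈p-y (Y⊆NS z∈Y) λ { refl → y∉Y z∈Y }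

¬Surplus⇔NBFC : ∀ (G : Graph q s) → q < s → (¬ Surplus G) ⇔ NBFC G
¬Surplus⇔NBFC G q<s = mk⇔ (λ ¬surplus fc → ¬surplus (factorCritical⇒surplus G fc))
                          (λ ¬fc surplus → ¬fc (surplus⇒factorCritical G q<s surplus))

-- Morse matchings from involutive pairings

infix 4 _≺_
_≺_ : List ℕ → List ℕ → Set
_≺_ = Lex-< _≡_ _<_

≺-trans : ∀ {xs ys zs} → xs ≺ ys → ys ≺ zs → xs ≺ zs
≺-trans = <-transitive isEquivalence (resp₂ _<_) <-trans

≺-irrefl : ∀ {xs} → ¬ xs ≺ xs
≺-irrefl = <-irreflexive <-irrefl (Pointwise.refl refl)

module _ {q s : ℕ} (pair : Graph q s → Maybe (Graph q s)) where

  Paired : Graph q s → Graph q s → Set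
  Paired σ τ = pair σ ≡ just τ × Arc σ τ

  module _ (pair-involutive : ∀ {σ τ} → pair σ ≡ just τ → pair τ ≡ just σ) where

    Paired-M1 : M1 Paired
    Paired-M1 a b c d v (a↦b , _) (c↦d , _) (inj₁ refl) (inj₁ refl) =
      refl , just-injective (trans (sym a↦b) c↦d)
    Paired-M1 a b c d v (a↦b , a→b) (c↦d , c→d) (inj₁ refl) (inj₂ refl) =
      contradiction c→d (Arc-asym (subst (Arc a) (just-injective (trans (sym a↦b) (pair-involutive c↦d))) a→b))
    Paired-M1 a b c d v (a↦b , a→b) (c↦d , c→d) (inj₂ refl) (inj₁ refl) =
      contradiction a→b (Arc-asym (subst (Arc b) (just-injective (trans (sym c↦d) (pair-involutive a↦b))) c→d))
    Paired-M1 a b c d v (a↦b , _) (c↦d , _) (inj₂ refl) (inj₂ refl) =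
      just-injective (trans (sym (pair-involutive a↦b)) (pair-involutive c↦d)) , refl

    Critical⇔unpaired : (∀ {σ τ} → pair σ ≡ just τ → Arc σ τ ⊎ Arc τ σ) →
                        ∀ σ → Critical Paired σ ⇔ pair σ ≡ nothing
    Critical⇔unpaired pair-adjacent σ = mk⇔ critical⇒unpaired unpaired⇒critical
      where
      critical⇒unpaired : Critical Paired σ → pair σ ≡ nothing
      critical⇒unpaired critical with pair σ in σ↦
      ... | nothing = refl
      ... | just τ with pair-adjacent σ↦
      ...   | inj₁ σ→τ = contradiction (τ , inj₁ (refl , σ→τ)) critical
      ...   | inj₂ τ→σ = contradiction (τ , inj₂ (pair-involutive σ↦ , τ→σ)) critical

      nothing≢just : ∀ {τ} → nothing ≢ just τ
      nothing≢just ()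

      unpaired⇒critical : pair σ ≡ nothing → Critical Paired σ
      unpaired⇒critical unpaired (τ , inj₁ (σ↦τ , _)) = nothing≢just (trans (sym unpaired) σ↦τ)
      unpaired⇒critical unpaired (τ , inj₂ (τ↦σ , _)) = nothing≢just (trans (sym unpaired) (pair-involutive τ↦σ))

  Paired-M2 : (potential : Graph q s → List ℕ) →
              (∀ {u v} → Reversed Paired u v → potential v ≺ potential u) → M2 Paired
  Paired-M2 potential descends u cycle = ≺-irrefl (descends⁺ cycle)
    where
    descends⁺ : ∀ {u v} → TransClosure (Reversed Paired) u v → potential v ≺ potential u
    descends⁺ [ step ]       = descends step
    descends⁺ (step ∷ steps) = ≺-trans (descends⁺ steps) (descends step)

-- Splitting off the first row and column

-- block b ρ c H has row 1 = b ∷ ρ and column 1̄ = b ∷ c; H is the graph on the other rows and columns.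
block : Bool → Subset s → Subset q → Graph q s → Graph (suc q) (suc s)
block b ρ c H = (b ∷ ρ) ∷ zipWith _∷_ c H

map-head-zipWith-∷ : ∀ (c : Subset q) (H : Graph q s) → map head (zipWith _∷_ c H) ≡ c
map-head-zipWith-∷ []      []      = refl
map-head-zipWith-∷ (x ∷ c) (r ∷ H) = cong (x ∷_) (map-head-zipWith-∷ c H)

map-tail-zipWith-∷ : ∀ (c : Subset q) (H : Graph q s) → map tail (zipWith _∷_ c H) ≡ H
map-tail-zipWith-∷ []      []      = refl
map-tail-zipWith-∷ (x ∷ c) (r ∷ H) = cong (r ∷_) (map-tail-zipWith-∷ c H)

zipWith-∷-head-tail : ∀ (rs : Graph q (suc s)) → zipWith _∷_ (map head rs) (map tail rs) ≡ rs
zipWith-∷-head-tail []             = refl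
zipWith-∷-head-tail ((x ∷ r) ∷ rs) = cong ((x ∷ r) ∷_) (zipWith-∷-head-tail rs)

block-injective : ∀ {b b′} {ρ ρ′ : Subset s} {c c′ : Subset q} {H H′ : Graph q s} → block b ρ c H ≡ block b′ ρ′ c′ H′ →
                  b ≡ b′ × ρ ≡ ρ′ × c ≡ c′ × H ≡ H′
block-injective {c = c} {c′} {H} {H′} eq with ∷-injective eq
... | row₀ , rest with ∷-injective row₀
...   | b≡b′ , ρ≡ρ′ = b≡b′ , ρ≡ρ′ ,
  trans (sym (map-head-zipWith-∷ c H)) (trans (cong (map head) rest) (map-head-zipWith-∷ c′ H′)) ,
  trans (sym (map-tail-zipWith-∷ c H)) (trans (cong (map tail) rest) (map-tail-zipWith-∷ c′ H′))

data BlockView {q s : ℕ} : Graph (suc q) (suc s) → Set where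
  block-view : ∀ b (ρ : Subset s) (c : Subset q) (H : Graph q s) → BlockView (block b ρ c H)

blockView : ∀ (G : Graph (suc q) (suc s)) → BlockView G
blockView ((b ∷ ρ) ∷ rs) =
  subst BlockView (cong ((b ∷ ρ) ∷_) (zipWith-∷-head-tail rs)) (block-view b ρ (map head rs) (map tail rs))

lookup-block : ∀ b ρ c (H : Graph q s) i → lookup (block b ρ c H) (suc i) ≡ lookup c i ∷ lookup H i
lookup-block b ρ c H i = lookup-zipWith _∷_ i c H

updateAt-zipWith-∷ : ∀ (c : Subset q) (H : Graph q s) i {f g} (h : Subset (suc s) → Subset (suc s)) →
                     (∀ x r → h (x ∷ r) ≡ f x ∷ g r) →
                     updateAt (zipWith _∷_ c H) i h ≡ zipWith _∷_ (updateAt c i f) (updateAt H i g)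
updateAt-zipWith-∷ (x ∷ c) (r ∷ H) zero    h h-∷ = cong (_∷ zipWith _∷_ c H) (h-∷ x r)
updateAt-zipWith-∷ (x ∷ c) (r ∷ H) (suc i) h h-∷ = cong ((x ∷ r) ∷_) (updateAt-zipWith-∷ c H i h h-∷)

removeEdge-block-row : ∀ b ρ c (H : Graph q s) j → removeEdge (block b ρ c H) zero (suc j) ≡ block b (ρ - j) c H
removeEdge-block-row b ρ c H j = cong (λ ρ′ → block b ρ′ c H) ([]≔outside≡- ρ j)

removeEdge-block-column : ∀ b ρ c (H : Graph q s) i → removeEdge (block b ρ c H) (suc i) zero ≡ block b ρ (c - i) H
removeEdge-block-column b ρ c H i = cong ((b ∷ ρ) ∷_) (begin
  updateAt (zipWith _∷_ c H) i (_[ zero ]≔ outside)            ≡⟨ updateAt-zipWith-∷ c H i _ (λ _ _ → refl) ⟩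
  zipWith _∷_ (c [ i ]≔ outside) (updateAt H i id)              ≡⟨ cong₂ (zipWith _∷_) ([]≔outside≡- c i) (updateAt-id i H) ⟩
  zipWith _∷_ (c - i) H                                         ∎)
  where open ≡-Reasoning

removeEdge-block-inner : ∀ b ρ c (H : Graph q s) i j →
                         removeEdge (block b ρ c H) (suc i) (suc j) ≡ block b ρ c (removeEdge H i j)
removeEdge-block-inner b ρ c H i j =
  cong ((b ∷ ρ) ∷_) (trans (updateAt-zipWith-∷ c H i _ (λ _ _ → refl)) (cong (λ c′ → zipWith _∷_ c′ _) (updateAt-id i c)))

data BlockArc (b : Bool) (ρ : Subset s) (c : Subset q) (H : Graph q s) :
              Bool → Subset s → Subset q → Graph q s → Set where
  corner : b ≡ true → BlockArc b ρ c H false ρ c H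
  row    : ∀ {j} → j ∈ₛ ρ → BlockArc b ρ c H b (ρ - j) c H
  column : ∀ {i} → i ∈ₛ c → BlockArc b ρ c H b ρ (c - i) H
  inner  : ∀ {i j} → Edge H i j → BlockArc b ρ c H b ρ c (removeEdge H i j)

Arc⇒BlockArc : ∀ {b b′} {ρ ρ′ : Subset s} {c c′ : Subset q} {H H′ : Graph q s} →
               Arc (block b ρ c H) (block b′ ρ′ c′ H′) → BlockArc b ρ c H b′ ρ′ c′ H′
Arc⇒BlockArc (zero , zero , b≡true , eq) with block-injective eq
... | refl , refl , refl , refl = corner b≡true
Arc⇒BlockArc {b = b} {ρ = ρ} {c = c} {H = H} (zero , suc j , e , eq)
  with block-injective (trans eq (removeEdge-block-row b ρ c H j))
... | refl , refl , refl , refl = row (lookup⇒[]= j ρ e)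
Arc⇒BlockArc {b = b} {ρ = ρ} {c = c} {H = H} (suc i , zero , e , eq)
  with block-injective (trans eq (removeEdge-block-column b ρ c H i))
... | refl , refl , refl , refl =
  column (lookup⇒[]= i c (subst (λ r → lookup r zero ≡ true) (lookup-block b ρ c H i) e))
Arc⇒BlockArc {b = b} {ρ = ρ} {c = c} {H = H} (suc i , suc j , e , eq)
  with block-injective (trans eq (removeEdge-block-inner b ρ c H i j))
... | refl , refl , refl , refl = inner (subst (λ r → lookup r (suc j) ≡ true) (lookup-block b ρ c H i) e)

Arc-block-inner : ∀ {b} {ρ : Subset s} {c : Subset q} {H H′ : Graph q s} → Arc H H′ → Arc (block b ρ c H) (block b ρ c H′)
Arc-block-inner {b = b} {ρ} {c} {H} (i , j , e , refl) =
  suc i , suc j , subst (λ r → lookup r (suc j) ≡ true) (sym (lookup-block b ρ c H i)) e ,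
  sym (removeEdge-block-inner b ρ c H i j)

Arc-block-inner⁻ : ∀ {b b′} {ρ ρ′ : Subset s} {c c′ : Subset q} {H H′ : Graph q s} →
                   Arc (block b ρ c H) (block b′ ρ′ c′ H′) → b′ ≡ b → ρ′ ≡ ρ → c′ ≡ c → Arc H H′
Arc-block-inner⁻ arc b′≡b ρ′≡ρ c′≡c with Arc⇒BlockArc arc
... | corner b≡true     = contradiction (trans b′≡b b≡true) false≢true
... | row {j} j∈ρ       = contradiction (subst (j ∈ₛ_) (sym ρ′≡ρ) j∈ρ) (x∉p-x _ j)
... | column {i} i∈c    = contradiction (subst (i ∈ₛ_) (sym c′≡c) i∈c) (x∉p-x _ i)
... | inner e           = _ , _ , e , refl

block-false⊆ᴳblock-true : ∀ ρ c (H : Graph q s) → block false ρ c H ⊆ᴳ block true ρ c H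
block-false⊆ᴳblock-true ρ c H = Arc⇒⊆ᴳ (zero , zero , refl , refl)

Empty-column : ∀ {b b′} {ρ ρ′ : Subset s} {c′ : Subset q} {H H′ : Graph q s} →
               BlockArc b ρ ∅ H b′ ρ′ c′ H′ → Empty c′
Empty-column (corner _)     = Empty-∅
Empty-column (row _)        = Empty-∅
Empty-column (column i∈∅)   = contradiction i∈∅ ∉⊥
Empty-column (inner _)      = Empty-∅

¬Surplus-without-corner : ∀ {b b′} {ρ ρ′ : Subset s} {c c′ : Subset q} {H H′ : Graph q s} →
                          ¬ Surplus (block false ρ c H) → BlockArc b ρ c H b′ ρ′ c′ H′ → ¬ Surplus (block false ρ′ c′ H′)
¬Surplus-without-corner ¬surplus (corner _) = ¬surplus
¬Surplus-without-corner {ρ = ρ} {c = c} {H = H} ¬surplus (row {j} j∈ρ) =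
  ¬surplus ∘ Surplus-mono (Arc⇒⊆ᴳ {σ = block false ρ c H}
                             (zero , suc j , []=⇒lookup j∈ρ , sym (removeEdge-block-row false ρ c H j)))
¬Surplus-without-corner {ρ = ρ} {c = c} {H = H} ¬surplus (column {i} i∈c) =
  ¬surplus ∘ Surplus-mono (Arc⇒⊆ᴳ {σ = block false ρ c H}
                             (suc i , zero , edge , sym (removeEdge-block-column false ρ c H i)))
  where
  edge : Edge (block false ρ c H) (suc i) zero
  edge = subst (λ r → lookup r zero ≡ true) (sym (lookup-block false ρ c H i)) ([]=⇒lookup i∈c)
¬Surplus-without-corner ¬surplus (inner {i} {j} e) = ¬surplus ∘ Surplus-mono (Arc⇒⊆ᴳ (Arc-block-inner (i , j , e , refl)))

meets : Subset q → Subset q → Bool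
meets []      []            = false
meets (x ∷ c) (inside  ∷ S) = x ∨ meets c S
meets (x ∷ c) (outside ∷ S) = meets c S

meets-∅ : ∀ (S : Subset q) → meets ∅ S ≡ false
meets-∅ []            = refl
meets-∅ (inside  ∷ S) = meets-∅ S
meets-∅ (outside ∷ S) = meets-∅ S

meets⁺ : ∀ {c S : Subset q} {i} → i ∈ₛ S → i ∈ₛ c → meets c S ≡ true
meets⁺ {c = x ∷ c} {inside  ∷ S} here        here        = refl
meets⁺ {c = x ∷ c} {inside  ∷ S} (there i∈S) (there i∈c) = trans (cong (x ∨_) (meets⁺ i∈S i∈c)) (∨-zeroʳ x)
meets⁺ {c = x ∷ c} {outside ∷ S} (there i∈S) (there i∈c) = meets⁺ i∈S i∈c

meets-false⇒∉ : ∀ {c S : Subset q} {i} → meets c S ≡ false → i ∈ₛ S → i ∉ₛ c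
meets-false⇒∉ disjoint i∈S i∈c = false≢true (trans (sym disjoint) (meets⁺ i∈S i∈c))

N-zipWith-∷ : ∀ (c : Subset q) (H : Graph q s) S → N (zipWith _∷_ c H) S ≡ meets c S ∷ N H S
N-zipWith-∷ []      []      []            = refl
N-zipWith-∷ (x ∷ c) (r ∷ H) (inside  ∷ S) = cong ((x ∷ r) ∪_) (N-zipWith-∷ c H S)
N-zipWith-∷ (x ∷ c) (r ∷ H) (outside ∷ S) = N-zipWith-∷ c H S

N-block-inside : ∀ b ρ c (H : Graph q s) S → N (block b ρ c H) (inside ∷ S) ≡ (b ∨ meets c S) ∷ (ρ ∪ N H S)
N-block-inside b ρ c H S = cong ((b ∷ ρ) ∪_) (N-zipWith-∷ c H S)

N-block-outside : ∀ b ρ c (H : Graph q s) S → N (block b ρ c H) (outside ∷ S) ≡ meets c S ∷ N H S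
N-block-outside b ρ c H S = N-zipWith-∷ c H S

-- Isolated columns and pendant paths

addIsolatedColumn : Graph q s → Graph q (suc s)
addIsolatedColumn = map (outside ∷_)

block-isolatedColumn : ∀ ρ (H : Graph q s) → block false ρ ∅ H ≡ addIsolatedColumn (ρ ∷ H)
block-isolatedColumn ρ H = cong ((outside ∷ ρ) ∷_) (zipWith-replicate₁ _∷_ outside H)

addIsolatedColumn-injective : ∀ {X Y : Graph q s} → addIsolatedColumn X ≡ addIsolatedColumn Y → X ≡ Y
addIsolatedColumn-injective {X = []}    {[]}    _  = refl
addIsolatedColumn-injective {X = r ∷ X} {r′ ∷ Y} eq with ∷-injective eq
... | rows≡ , rest≡ = cong₂ _∷_ (proj₂ (∷-injective rows≡)) (addIsolatedColumn-injective rest≡)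

N-addIsolatedColumn : ∀ (X : Graph q s) S → N (addIsolatedColumn X) S ≡ outside ∷ N X S
N-addIsolatedColumn []      []            = refl
N-addIsolatedColumn (r ∷ X) (inside  ∷ S) = cong ((outside ∷ r) ∪_) (N-addIsolatedColumn X S)
N-addIsolatedColumn (r ∷ X) (outside ∷ S) = N-addIsolatedColumn X S

Surplus-addIsolatedColumn : ∀ (X : Graph q s) → Surplus (addIsolatedColumn X) ⇔ Surplus X
Surplus-addIsolatedColumn X = mk⇔
  (λ surplus S nonempty → subst (λ N′ → ∣ S ∣ < ∣ N′ ∣) (N-addIsolatedColumn X S) (surplus S nonempty))
  (λ surplus S nonempty → subst (λ N′ → ∣ S ∣ < ∣ N′ ∣) (sym (N-addIsolatedColumn X S)) (surplus S nonempty))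

Surplus-block-false-∅ : ∀ ρ (H : Graph q s) → Surplus (block false ρ ∅ H) ⇔ Surplus (ρ ∷ H)
Surplus-block-false-∅ ρ H rewrite block-isolatedColumn ρ H = Surplus-addIsolatedColumn (ρ ∷ H)

numEdges-addIsolatedColumn : ∀ (X : Graph q s) → numEdges (addIsolatedColumn X) ≡ numEdges X
numEdges-addIsolatedColumn []      = refl
numEdges-addIsolatedColumn (r ∷ X) = cong (countᵇ id r +_) (numEdges-addIsolatedColumn X)

removeEdge-addIsolatedColumn : ∀ (X : Graph q s) i j →
                               removeEdge (addIsolatedColumn X) i (suc j) ≡ addIsolatedColumn (removeEdge X i j)
removeEdge-addIsolatedColumn (r ∷ X) zero    j = refl
removeEdge-addIsolatedColumn (r ∷ X) (suc i) j = cong ((outside ∷ r) ∷_) (removeEdge-addIsolatedColumn X i j)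

lookup-addIsolatedColumn : ∀ (X : Graph q s) i → lookup (addIsolatedColumn X) i ≡ outside ∷ lookup X i
lookup-addIsolatedColumn X i = lookup-map i (outside ∷_) X

Arc-addIsolatedColumn : ∀ {X Y : Graph q s} → Arc X Y → Arc (addIsolatedColumn X) (addIsolatedColumn Y)
Arc-addIsolatedColumn {X = X} (i , j , e , refl) =
  i , suc j , subst (λ r → lookup r (suc j) ≡ true) (sym (lookup-addIsolatedColumn X i)) e ,
  sym (removeEdge-addIsolatedColumn X i j)

Arc-addIsolatedColumn⁻ : ∀ {X : Graph q s} {τ} → Arc (addIsolatedColumn X) τ →
                         ∃ λ Y → τ ≡ addIsolatedColumn Y × Arc X Y
Arc-addIsolatedColumn⁻ {X = X} (i , zero , e , _) =
  contradiction (subst (λ r → lookup r zero ≡ true) (lookup-addIsolatedColumn X i) e) false≢true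
Arc-addIsolatedColumn⁻ {X = X} (i , suc j , e , refl) =
  removeEdge X i j , removeEdge-addIsolatedColumn X i j ,
  i , j , subst (λ r → lookup r (suc j) ≡ true) (lookup-addIsolatedColumn X i) e , refl

addPendantPath : Graph q (suc s) → Graph (suc q) (suc (suc s))
addPendantPath H = block true (inside ∷ ∅) ∅ H

N-block-∅-inside : ∀ b ρ (H : Graph q s) S → N (block b ρ ∅ H) (inside ∷ S) ≡ b ∷ (ρ ∪ N H S)
N-block-∅-inside b ρ H S = begin
  N (block b ρ ∅ H) (inside ∷ S)  ≡⟨ N-block-inside b ρ ∅ H S ⟩
  (b ∨ meets ∅ S) ∷ (ρ ∪ N H S)   ≡⟨ cong (λ x → (b ∨ x) ∷ (ρ ∪ N H S)) (meets-∅ S) ⟩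
  (b ∨ false) ∷ (ρ ∪ N H S)       ≡⟨ cong (_∷ (ρ ∪ N H S)) (∨-identityʳ b) ⟩
  b ∷ (ρ ∪ N H S)                 ∎
  where open ≡-Reasoning

N-block-∅-outside : ∀ b ρ (H : Graph q s) S → N (block b ρ ∅ H) (outside ∷ S) ≡ outside ∷ N H S
N-block-∅-outside b ρ H S = trans (N-block-outside b ρ ∅ H S) (cong (_∷ N H S) (meets-∅ S))

Surplus-block-true-∅ : ∀ {q s} ρ (H : Graph q s) → Surplus (block true ρ ∅ H) ⇔ (Surplus H × Nonempty ρ)
Surplus-block-true-∅ {q} ρ H = mk⇔ (λ surplus → surplus-H surplus , nonempty-ρ surplus) surplus-block
  where
  surplus-H : Surplus (block true ρ ∅ H) → Surplus H
  surplus-H surplus S (i , i∈S) =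
    subst (λ N′ → ∣ S ∣ < ∣ N′ ∣) (N-block-∅-outside true ρ H S) (surplus (outside ∷ S) (suc i , there i∈S))

  nonempty-ρ : Surplus (block true ρ ∅ H) → Nonempty ρ
  nonempty-ρ surplus with ∣p∣>0⇒Nonempty (subst (_< ∣ ρ ∪ N H ∅ ∣) (∣⊥∣≡0 q) (s≤s⁻¹
    (subst (λ N′ → suc ∣ ∅ {q} ∣ < ∣ N′ ∣) (N-block-∅-inside true ρ H ∅) (surplus (inside ∷ ∅) (zero , here)))))
  ... | y , y∈ρ∪N∅ with x∈p∪q⁻ ρ (N H ∅) y∈ρ∪N∅
  ...   | inj₁ y∈ρ  = y , y∈ρ
  ...   | inj₂ y∈N∅ = contradiction (proj₁ (proj₂ (∈N⁻ H ∅ y∈N∅))) ∉⊥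

  ∣S∣<∣ρ∪NS∣ : Surplus H → Nonempty ρ → ∀ S → ∣ S ∣ < ∣ ρ ∪ N H S ∣
  ∣S∣<∣ρ∪NS∣ surplus nonemptyρ S with nonempty? S
  ... | yes nonempty = <-≤-trans (surplus S nonempty) (∣q∣≤∣p∪q∣ ρ (N H S))
  ... | no  empty    =
    <-≤-trans (subst (_< ∣ ρ ∣) (sym (∣Empty∣≡0 empty)) (Nonempty⇒∣p∣>0 nonemptyρ)) (∣p∣≤∣p∪q∣ ρ (N H S))

  surplus-block : Surplus H × Nonempty ρ → Surplus (block true ρ ∅ H)
  surplus-block (surplus , nonemptyρ) (inside ∷ S) _ =
    subst (λ N′ → suc ∣ S ∣ < ∣ N′ ∣) (sym (N-block-∅-inside true ρ H S)) (s≤s (∣S∣<∣ρ∪NS∣ surplus nonemptyρ S))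
  surplus-block (surplus , _) (outside ∷ S) nonempty =
    subst (λ N′ → ∣ S ∣ < ∣ N′ ∣) (sym (N-block-∅-outside true ρ H S)) (surplus S (Nonempty-tail nonempty))

Surplus-addPendantPath : ∀ {H : Graph q (suc s)} → Surplus H → Surplus (addPendantPath H)
Surplus-addPendantPath {H = H} surplus = Equivalence.from (Surplus-block-true-∅ (inside ∷ ∅) H) (surplus , zero , here)

numEdges-addPendantPath : ∀ (H : Graph q (suc s)) → numEdges (addPendantPath H) ≡ 2 + numEdges H
numEdges-addPendantPath {s = s} H = cong₂ (λ k m → 2 + (k + m))
  (trans (countᵇ-id≡∣∣ (∅ {s})) (∣⊥∣≡0 s))
  (trans (cong numEdges (zipWith-replicate₁ _∷_ outside H)) (numEdges-addIsolatedColumn H))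

addPendantPath-injective : ∀ {H H′ : Graph q (suc s)} → addPendantPath H ≡ addPendantPath H′ → H ≡ H′
addPendantPath-injective eq = proj₂ (proj₂ (proj₂ (block-injective eq)))

-- Witnesses that the corner edge is essential

-- S witnesses that the corner of block true ρ c H is essential: the rows {1} ∪ S have exactly one
-- more neighbour than there are rows, and only row 1 is adjacent to column 1̄.
Witness : Subset s → Subset q → Graph q s → Subset q → Set
Witness ρ c H S = meets c S ≡ false × ∣ ρ ∪ N H S ∣ ≡ suc ∣ S ∣

witness? : ∀ ρ c (H : Graph q s) S → Dec (Witness ρ c H S)
witness? ρ c H S = meets c S ≟ᵇ false ×-dec ∣ ρ ∪ N H S ∣ ≟ℕ suc ∣ S ∣

Surplus⇒∣S∣<∣ρ∪NS∣ : ∀ {ρ c} {H : Graph q s} → Surplus (block true ρ c H) → ∀ S → ∣ S ∣ < ∣ ρ ∪ N H S ∣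
Surplus⇒∣S∣<∣ρ∪NS∣ {ρ = ρ} {c} {H} surplus S =
  s≤s⁻¹ (subst (λ N′ → suc ∣ S ∣ < ∣ N′ ∣) (N-block-inside true ρ c H S) (surplus (inside ∷ S) (zero , here)))

witness-exists : ∀ ρ c (H : Graph q s) → Surplus (block true ρ c H) → ¬ Surplus (block false ρ c H) →
                 ∃ (Witness ρ c H)
witness-exists ρ c H surplus ¬surplus₀ with ¬Surplus⇒violator (block false ρ c H) ¬surplus₀
... | outside ∷ S , nonempty , small = contradiction (surplus (outside ∷ S) nonempty) (≤⇒≯ small)
... | inside  ∷ S , _        , small =
  S , witness-of (meets c S) (subst (λ N′ → ∣ N′ ∣ ≤ suc ∣ S ∣) (N-block-inside false ρ c H S) small) refl
  where
  witness-of : ∀ x → ∣ x ∷ (ρ ∪ N H S) ∣ ≤ suc ∣ S ∣ → meets c S ≡ x → Witness ρ c H S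
  witness-of true  small′ _        = contradiction (s≤s⁻¹ small′) (<⇒≱ (Surplus⇒∣S∣<∣ρ∪NS∣ surplus S))
  witness-of false small′ disjoint = disjoint , ≤-antisym small′ (Surplus⇒∣S∣<∣ρ∪NS∣ surplus S)

Witness⇒¬Surplus : ∀ {ρ c} {H : Graph q s} {S} → Witness ρ c H S → ¬ Surplus (block false ρ c H)
Witness⇒¬Surplus {ρ = ρ} {c} {H} {S} (disjoint , tight) surplus₀ = <-irrefl (sym tight) (begin-strict
  suc ∣ S ∣                               <⟨ surplus₀ (inside ∷ S) (zero , here) ⟩
  ∣ N (block false ρ c H) (inside ∷ S) ∣  ≡⟨ cong ∣_∣ (N-block-inside false ρ c H S) ⟩
  ∣ meets c S ∷ (ρ ∪ N H S) ∣             ≡⟨ cong (λ x → ∣ x ∷ (ρ ∪ N H S) ∣) disjoint ⟩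
  ∣ ρ ∪ N H S ∣                           ∎)
  where open ≤-Reasoning

Witnessed : Subset s → Subset q → Graph q s → Fin s → Set
Witnessed ρ c H z = ∃ λ S → Witness ρ c H S × z ∈ₛ ρ ∪ N H S

witnessed? : ∀ ρ c (H : Graph q s) z → Dec (Witnessed ρ c H z)
witnessed? ρ c H z = anySubset? λ S → witness? ρ c H S ×-dec z ∈? (ρ ∪ N H S)

Witness⇒Witnessed : ∀ {ρ c} {H : Graph q s} {S} → Witness ρ c H S → ∃ (Witnessed ρ c H)
Witness⇒Witnessed {S = S} witness@(_ , tight) with ∣p∣>0⇒Nonempty (subst (0 <_) (sym tight) (s≤s z≤n))
... | z , z∈U = z , S , witness , z∈U

Surplus-removeEdge-witnessed : ∀ {ρ c} {H : Graph q s} {m z} → Surplus (block true ρ c H) → m ∈ₛ c →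
                               Witnessed ρ c H z → Surplus (block true ρ c (removeEdge H m z))
Surplus-removeEdge-witnessed {ρ = ρ} {c} {H} {m} {z} surplus m∈c (S , (disjoint , tight) , z∈U) =
  subst Surplus (removeEdge-block-inner true ρ c H m z)
    (Surplus-removeEdge (block true ρ c H) {inside ∷ S} {suc m} {suc z} {zero} surplus
      (trans (cong ∣_∣ NX≡) (cong suc tight))
      (λ { (there m∈S) → meets-false⇒∉ disjoint m∈S m∈c })
      (subst (suc z ∈ₛ_) (sym NX≡) (there z∈U))
      (subst (zero ∈ₛ_) (sym NX≡) here)
      (λ ())
      zero∈row)
  where
  NX≡ : N (block true ρ c H) (inside ∷ S) ≡ inside ∷ (ρ ∪ N H S)
  NX≡ = N-block-inside true ρ c H S

  zero∈row : zero ∈ₛ lookup (block true ρ c H) (suc m)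
  zero∈row = subst (zero ∈ₛ_) (sym (lookup-block true ρ c H m))
                   (subst (λ x → zero ∈ₛ x ∷ lookup H m) (sym ([]=⇒lookup m∈c)) here)

Witnessed-⊆ : ∀ {ρ ρ′ c} {H H′ : Graph q s} {z} → Surplus (block true ρ′ c H′) → ρ′ ⊆ ρ → H′ ⊆ᴳ H →
              Witnessed ρ c H z → Witnessed ρ′ c H′ z
Witnessed-⊆ {ρ = ρ} {ρ′} {c} {H} {H′} surplus′ ρ′⊆ρ H′⊆H (S , (disjoint , tight) , z∈U) =
  S , (disjoint , ∣U′∣≡) , p⊆q∧∣q∣≤∣p∣⇒q⊆p U′⊆U (≤-reflexive (trans tight (sym ∣U′∣≡))) z∈U
  where
  U′⊆U : ρ′ ∪ N H′ S ⊆ ρ ∪ N H S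
  U′⊆U y∈ with x∈p∪q⁻ ρ′ (N H′ S) y∈
  ... | inj₁ y∈ρ′  = x∈p∪q⁺ (inj₁ (ρ′⊆ρ y∈ρ′))
  ... | inj₂ y∈NH′ = x∈p∪q⁺ (inj₂ (N-monoˡ H′⊆H y∈NH′))

  ∣U′∣≡ : ∣ ρ′ ∪ N H′ S ∣ ≡ suc ∣ S ∣
  ∣U′∣≡ = ≤-antisym (≤-trans (p⊆q⇒∣p∣≤∣q∣ U′⊆U) (≤-reflexive tight)) (Surplus⇒∣S∣<∣ρ∪NS∣ surplus′ S)

Witnessed-rows : ∀ {ρ c} {H H′ : Graph q s} {m z} → m ∈ₛ c → (∀ {i} → i ≢ m → lookup H i ≡ lookup H′ i) →
                 Witnessed ρ c H z → Witnessed ρ c H′ z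
Witnessed-rows {ρ = ρ} {c} {H} {H′} {m} m∈c rows≡ (S , (disjoint , tight) , z∈U) =
  S , (disjoint , subst (λ N′ → ∣ ρ ∪ N′ ∣ ≡ suc ∣ S ∣) NS≡ tight) , subst (λ N′ → _ ∈ₛ ρ ∪ N′) NS≡ z∈U
  where
  NS≡ : N H S ≡ N H′ S
  NS≡ = N-cong H H′ S λ i∈S → rows≡ λ { refl → meets-false⇒∉ disjoint i∈S m∈c }

-- The pairing, its potential and the unpaired graphs

data Kind : Set where
  deficient isolatedColumn pendantPath toggleRow toggleInner toggleCorner : Kind

-- Deleting an edge never moves a graph to a kind of higher rank.
rank : Kind → ℕ
rank deficient      = 0
rank isolatedColumn = 1
rank pendantPath    = 2
rank toggleRow      = 3
rank toggleInner    = 4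
rank toggleCorner   = 5

classify : (surplus nonemptyColumn corner nonemptyRowTail surplusWithoutCorner : Bool) → Kind
classify false _     _     _     _     = deficient
classify true  false false _     _     = isolatedColumn
classify true  false true  false _     = pendantPath
classify true  false true  true  _     = toggleRow
classify true  true  false _     _     = toggleCorner
classify true  true  true  _     true  = toggleCorner
classify true  true  true  _     false = toggleInner

nonemptyTail : Subset s → Bool
nonemptyTail []      = false
nonemptyTail (_ ∷ ρ) = does (nonempty? ρ)

kind : Bool → Subset s → Subset q → Graph q s → Kind
kind b ρ c H = classify (does (surplus? (block b ρ c H))) (does (nonempty? c)) b (nonemptyTail ρ)
                        (does (surplus? (block false ρ c H)))

data KindSpec {q} : ∀ {s} → Bool → Subset s → Subset q → Graph q s → Kind → Set where
  deficient      : ∀ {s b ρ c} {H : Graph q s} → ¬ Surplus (block b ρ c H) → KindSpec b ρ c H deficient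
  isolatedColumn : ∀ {s ρ c} {H : Graph q s} → c ≡ ∅ → Surplus (ρ ∷ H) → KindSpec false ρ c H isolatedColumn
  pendantPath    : ∀ {s ρ c} {H : Graph q (suc s)} → c ≡ ∅ → ρ ≡ inside ∷ ∅ → Surplus H →
                   KindSpec true ρ c H pendantPath
  toggleRow      : ∀ {s ρ c} {H : Graph q (suc s)} → c ≡ ∅ → Nonempty (tail ρ) → Surplus H →
                   KindSpec true ρ c H toggleRow
  toggleCorner   : ∀ {s b ρ c} {H : Graph q s} → Nonempty c → Surplus (block false ρ c H) →
                   KindSpec b ρ c H toggleCorner
  toggleInner    : ∀ {s ρ c} {H : Graph q s} → Nonempty c → Surplus (block true ρ c H) →
                   ¬ Surplus (block false ρ c H) → KindSpec true ρ c H toggleInner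

corner-spec : ∀ b ρ c (H : Graph q s) → Nonempty c → Surplus (block b ρ c H) →
              KindSpec b ρ c H (classify true true b (nonemptyTail ρ) (does (surplus? (block false ρ c H))))
corner-spec false ρ c H c≢∅ surplus = toggleCorner c≢∅ surplus
corner-spec true  ρ c H c≢∅ surplus with surplus? (block false ρ c H)
... | yes surplus₀ = toggleCorner c≢∅ surplus₀
... | no ¬surplus₀ = toggleInner c≢∅ surplus ¬surplus₀

row-spec : ∀ b ρ (H : Graph q s) → Surplus (block b ρ ∅ H) →
           KindSpec b ρ ∅ H (classify true false b (nonemptyTail ρ) (does (surplus? (block false ρ ∅ H))))
row-spec false ρ H surplus =
  isolatedColumn refl (Equivalence.to (Surplus-block-false-∅ ρ H) surplus)
row-spec true [] H surplus = contradiction (Surplus⇒q<s (block true [] ∅ H) surplus) λ { (s≤s ()) }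
row-spec true (t ∷ ρ) H surplus with Equivalence.to (Surplus-block-true-∅ (t ∷ ρ) H) surplus | nonempty? ρ
... | surplusH , _       | yes tail≢∅ = toggleRow refl tail≢∅ surplusH
... | surplusH , row≢∅   | no  tail≡∅ =
  pendantPath refl (cong₂ _∷_ (Nonempty-∷⇒head row≢∅ tail≡∅) (Empty-unique tail≡∅)) surplusH

kind-spec : ∀ b ρ c (H : Graph q s) → KindSpec b ρ c H (kind b ρ c H)
kind-spec b ρ c H with surplus? (block b ρ c H) | nonempty? c
... | no  ¬surplus | _         = deficient ¬surplus
... | yes surplus  | yes c≢∅   = corner-spec b ρ c H c≢∅ surplus
... | yes surplus  | no  empty with Empty-unique empty
...   | refl = row-spec b ρ H surplus

kind-unique : ∀ {b ρ c} {H : Graph q s} {k} → KindSpec b ρ c H k → kind b ρ c H ≡ k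
kind-unique {b = b} {ρ} {c} {H} (deficient ¬surplus)
  rewrite dec-false (surplus? (block b ρ c H)) ¬surplus = refl
kind-unique {q} {ρ = ρ} {H = H} (isolatedColumn refl surplus)
  rewrite dec-true (surplus? (block false ρ ∅ H)) (Equivalence.from (Surplus-block-false-∅ ρ H) surplus)
        | dec-false (nonempty? (∅ {q})) Empty-∅ = refl
kind-unique {q} {suc s} {H = H} (pendantPath refl refl surplus)
  rewrite dec-true (surplus? (block true (inside ∷ ∅) ∅ H)) (Surplus-addPendantPath surplus)
        | dec-false (nonempty? (∅ {q})) Empty-∅
        | dec-false (nonempty? (∅ {s})) Empty-∅ = refl
kind-unique {q} {ρ = t ∷ ρ} {H = H} (toggleRow refl (i , i∈ρ) surplus)
  rewrite dec-true (surplus? (block true (t ∷ ρ) ∅ H))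
                   (Equivalence.from (Surplus-block-true-∅ (t ∷ ρ) H) (surplus , suc i , there i∈ρ))
        | dec-false (nonempty? (∅ {q})) Empty-∅
        | dec-true (nonempty? ρ) (i , i∈ρ) = refl
kind-unique {b = false} {ρ} {c} {H} (toggleCorner c≢∅ surplus₀)
  rewrite dec-true (surplus? (block false ρ c H)) surplus₀
        | dec-true (nonempty? c) c≢∅ = refl
kind-unique {b = true} {ρ} {c} {H} (toggleCorner c≢∅ surplus₀)
  rewrite dec-true (surplus? (block true ρ c H)) (Surplus-mono (block-false⊆ᴳblock-true ρ c H) surplus₀)
        | dec-true (nonempty? c) c≢∅
        | dec-true (surplus? (block false ρ c H)) surplus₀ = refl
kind-unique {ρ = ρ} {c} {H} (toggleInner c≢∅ surplus ¬surplus₀)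
  rewrite dec-true (surplus? (block true ρ c H)) surplus
        | dec-true (nonempty? c) c≢∅
        | dec-false (surplus? (block false ρ c H)) ¬surplus₀ = refl

-- In a toggled pair G ⊃ G - e the weights are |E(G)| < |E(G)| + 1, and deleting any other edge
-- lowers the weight; so both kinds of arcs of the modified Hasse diagram descend.
weight : ℕ → Bool → ℕ
weight edges true  = edges
weight edges false = 2 + edges

firstMember : Subset q → Maybe (Fin q)
firstMember c = proj₁ (least (_∈? c))

firstWitnessed : Subset s → Subset q → Graph q s → Maybe (Fin s)
firstWitnessed ρ c H = proj₁ (least (witnessed? ρ c H))

-- Witnesses survive in surplus subgraphs (Witnessed-⊆), so deleting edges can only move the chosen
-- column z to the left; this is why z appears in the potential.
innerEdge : Subset s → Subset q → Graph q s → Maybe (Fin q × Fin s)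
innerEdge ρ c H = Maybe.zip (firstMember c) (firstWitnessed ρ c H)

mutual
  pair : Graph q s → Maybe (Graph q s)
  pair {zero}          _              = nothing
  pair {suc q} {zero}  _              = nothing
  pair {suc q} {suc s} ((b ∷ ρ) ∷ rs) = pairKind b ρ (map head rs) (map tail rs)

  pairKind : Bool → Subset s → Subset q → Graph q s → Maybe (Graph (suc q) (suc s))
  pairKind b ρ c H = pairBlock (kind b ρ c H) b ρ c H

  pairBlock : Kind → Bool → Subset s → Subset q → Graph q s → Maybe (Graph (suc q) (suc s))
  pairBlock deficient      b ρ       c H = nothing
  pairBlock isolatedColumn b ρ       c H = Maybe.map addIsolatedColumn (pair (ρ ∷ H))
  pairBlock pendantPath    b ρ       c H = Maybe.map (block b ρ c) (pair H)
  pairBlock toggleRow      b []      c H = nothing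
  pairBlock toggleRow      b (t ∷ ρ) c H = just (block b (not t ∷ ρ) c H)
  pairBlock toggleInner    b ρ       c H = Maybe.map (λ (m , z) → block b ρ c (toggleEdge H m z)) (innerEdge ρ c H)
  pairBlock toggleCorner   b ρ       c H = just (block (not b) ρ c H)

innerKey : ℕ → Graph q s → Fin q × Fin s → List ℕ
innerKey edges H (m , z) = toℕ z ∷ weight edges (lookup (lookup H m) z) ∷ []

mutual
  potential : Graph q s → List ℕ
  potential {zero}          _              = []
  potential {suc q} {zero}  _              = []
  potential {suc q} {suc s} ((b ∷ ρ) ∷ rs) = potentialKind b ρ (map head rs) (map tail rs)

  potentialKind : Bool → Subset s → Subset q → Graph q s → List ℕ
  potentialKind b ρ c H = rank (kind b ρ c H) ∷ tiebreak (kind b ρ c H) b ρ c H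

  tiebreak : Kind → Bool → Subset s → Subset q → Graph q s → List ℕ
  tiebreak deficient      b ρ       c H = numEdges (block b ρ c H) ∷ []
  tiebreak isolatedColumn b ρ       c H = potential (ρ ∷ H)
  tiebreak pendantPath    b ρ       c H = potential H
  tiebreak toggleRow      b []      c H = []
  tiebreak toggleRow      b (t ∷ ρ) c H = weight (numEdges (block b (t ∷ ρ) c H)) t ∷ []
  tiebreak toggleInner    b ρ       c H = ∣ c ∣ ∷ Maybe.maybe′ (innerKey (numEdges (block b ρ c H)) H) [] (innerEdge ρ c H)
  tiebreak toggleCorner   b ρ       c H = weight (numEdges (block b ρ c H)) b ∷ []

L : ∀ q s → List (Graph q s)
L zero    s             = [] ∷ []
L (suc q) zero          = []
L (suc q) (suc zero)    = []
L (suc q) (suc (suc s)) = List.map addIsolatedColumn (L (suc q) (suc s)) ++ List.map addPendantPath (L q (suc s))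

pair-block : ∀ b ρ c (H : Graph q s) → pair (block b ρ c H) ≡ pairBlock (kind b ρ c H) b ρ c H
pair-block b ρ c H rewrite map-head-zipWith-∷ c H | map-tail-zipWith-∷ c H = refl

potential-block : ∀ b ρ c (H : Graph q s) → potential (block b ρ c H) ≡ rank (kind b ρ c H) ∷ tiebreak (kind b ρ c H) b ρ c H
potential-block b ρ c H rewrite map-head-zipWith-∷ c H | map-tail-zipWith-∷ c H = refl

pair-of : ∀ {b ρ c} {H : Graph q s} {k} → KindSpec b ρ c H k → pair (block b ρ c H) ≡ pairBlock k b ρ c H
pair-of {b = b} {ρ} {c} {H} spec = trans (pair-block b ρ c H) (cong (λ k → pairBlock k b ρ c H) (kind-unique spec))

potential-of : ∀ {b ρ c} {H : Graph q s} {k} → KindSpec b ρ c H k →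
               potential (block b ρ c H) ≡ rank k ∷ tiebreak k b ρ c H
potential-of {b = b} {ρ} {c} {H} spec =
  trans (potential-block b ρ c H) (cong (λ k → rank k ∷ tiebreak k b ρ c H) (kind-unique spec))

innerEdge-just : ∀ {ρ c} {H : Graph q s} → Nonempty c → Surplus (block true ρ c H) → ¬ Surplus (block false ρ c H) →
                 ∃ λ m → ∃ λ z → firstMember c ≡ just m × firstWitnessed ρ c H ≡ just z × m ∈ₛ c × Witnessed ρ c H z
innerEdge-just {ρ = ρ} {c} {H} (i , i∈c) surplus ¬surplus₀
  with least-just (_∈? c) i∈c
     | least-just (witnessed? ρ c H)
                  (proj₂ (Witness⇒Witnessed {ρ = ρ} {c} {H} (proj₂ (witness-exists ρ c H surplus ¬surplus₀))))
... | m , first≡m , m∈c , _ | z , least≡z , witnessed , _ =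
  m , z , first≡m , least≡z , m∈c , witnessed

-- Invariants of the pairing, by induction on the size

record Partners (σ τ : Graph q s) : Set where
  field
    surplus  : Surplus σ
    back     : pair τ ≡ just σ
    adjacent : Arc σ τ ⊎ Arc τ σ

record Invariants (q s : ℕ) : Set where
  field
    partners     : ∀ {σ τ : Graph q s} → pair σ ≡ just τ → Partners σ τ
    unpaired⇒∈L : ∀ {σ : Graph q s} → Surplus σ → pair σ ≡ nothing → σ ∈ L q s
    ∈L⇒unpaired : ∀ {σ : Graph q s} → σ ∈ L q s → pair σ ≡ nothing × Surplus σ × numEdges σ ≡ 2 * q
    descends     : ∀ {u v : Graph q s} → Reversed (Paired pair) u v → potential v ≺ potential u

module _ (I : Invariants q s) where
  open Invariants I

  ¬Surplus⇒unpaired : ∀ {σ : Graph q s} → ¬ Surplus σ → pair σ ≡ nothing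
  ¬Surplus⇒unpaired {σ} ¬surplus with pair σ in σ↦
  ... | nothing = refl
  ... | just τ  = contradiction (Partners.surplus (partners σ↦)) ¬surplus

  Surplus-partner : ∀ {σ τ : Graph q s} → pair σ ≡ just τ → Surplus τ
  Surplus-partner σ↦τ = Partners.surplus (partners (Partners.back (partners σ↦τ)))

  pair-involutive : ∀ {σ τ : Graph q s} → pair σ ≡ just τ → pair τ ≡ just σ
  pair-involutive σ↦τ = Partners.back (partners σ↦τ)

  pair-adjacent : ∀ {σ τ : Graph q s} → pair σ ≡ just τ → Arc σ τ ⊎ Arc τ σ
  pair-adjacent σ↦τ = Partners.adjacent (partners σ↦τ)

  morseMatching : MorseMatching (Paired pair)
  morseMatching = record
    { arcs     = λ _ _ → proj₂
    ; matching = Paired-M1 pair pair-involutive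
    ; acyclic  = Paired-M2 pair potential descends
    }

  unpaired⇔ : ∀ σ → pair σ ≡ nothing ⇔ (¬ Surplus σ ⊎ σ ∈ L q s)
  unpaired⇔ σ = mk⇔ unpaired⇒ ⇒unpaired
    where
    unpaired⇒ : pair σ ≡ nothing → ¬ Surplus σ ⊎ σ ∈ L q s
    unpaired⇒ unpaired with surplus? σ
    ... | yes surplus = inj₂ (unpaired⇒∈L surplus unpaired)
    ... | no ¬surplus = inj₁ ¬surplus

    ⇒unpaired : ¬ Surplus σ ⊎ σ ∈ L q s → pair σ ≡ nothing
    ⇒unpaired (inj₁ ¬surplus) = ¬Surplus⇒unpaired ¬surplus
    ⇒unpaired (inj₂ σ∈L)      = proj₁ (∈L⇒unpaired σ∈L)

  L-factorCritical : q < s → All (λ G → (numEdges G ≡ 2 * q) × FactorCritical G) (L q s)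
  L-factorCritical q<s = All.tabulate λ {σ} σ∈L → let (_ , surplus , edges) = ∈L⇒unpaired σ∈L in
    edges , surplus⇒factorCritical σ q<s surplus

pair-addIsolatedColumn : Invariants (suc q) s → ∀ (X : Graph (suc q) s) →
                         pair (addIsolatedColumn X) ≡ Maybe.map addIsolatedColumn (pair X)
pair-addIsolatedColumn I (ρ ∷ H) with surplus? (ρ ∷ H)
... | yes surplus = trans (cong pair (sym (block-isolatedColumn ρ H))) (pair-of (isolatedColumn refl surplus))
... | no ¬surplus = begin
  pair (addIsolatedColumn (ρ ∷ H))
    ≡⟨ cong pair (block-isolatedColumn ρ H) ⟨
  pair (block false ρ ∅ H)
    ≡⟨ pair-of (deficient (¬surplus ∘ Equivalence.to (Surplus-block-false-∅ ρ H))) ⟩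
  nothing
    ≡⟨ cong (Maybe.map addIsolatedColumn) (¬Surplus⇒unpaired I ¬surplus) ⟨
  Maybe.map addIsolatedColumn (pair (ρ ∷ H))
    ∎
  where open ≡-Reasoning

potential-addIsolatedColumn : ∀ {X : Graph (suc q) s} → Surplus X → potential (addIsolatedColumn X) ≡ 1 ∷ potential X
potential-addIsolatedColumn {X = ρ ∷ H} surplus =
  trans (cong potential (sym (block-isolatedColumn ρ H))) (potential-of (isolatedColumn refl surplus))

pair-addPendantPath : Invariants q (suc s) → ∀ (H : Graph q (suc s)) →
                      pair (addPendantPath H) ≡ Maybe.map addPendantPath (pair H)
pair-addPendantPath I H with surplus? H
... | yes surplus = pair-of (pendantPath refl refl surplus)
... | no ¬surplus =
  trans (pair-of (deficient (¬surplus ∘ proj₁ ∘ Equivalence.to (Surplus-block-true-∅ (inside ∷ ∅) H))))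
        (cong (Maybe.map addPendantPath) (sym (¬Surplus⇒unpaired I ¬surplus)))

potential-addPendantPath : ∀ {H : Graph q (suc s)} → Surplus H → potential (addPendantPath H) ≡ 2 ∷ potential H
potential-addPendantPath surplus = potential-of (pendantPath refl refl surplus)

Partners-addIsolatedColumn : Invariants (suc q) s → ∀ {X Y : Graph (suc q) s} → Partners X Y →
                             Partners (addIsolatedColumn X) (addIsolatedColumn Y)
Partners-addIsolatedColumn I {X} {Y} partners = record
  { surplus  = Equivalence.from (Surplus-addIsolatedColumn X) surplus
  ; back     = trans (pair-addIsolatedColumn I Y) (cong (Maybe.map addIsolatedColumn) back)
  ; adjacent = Sum.map Arc-addIsolatedColumn Arc-addIsolatedColumn adjacent
  }
  where open Partners partners

Partners-addPendantPath : Invariants q (suc s) → ∀ {H H′ : Graph q (suc s)} → Partners H H′ →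
                          Partners (addPendantPath H) (addPendantPath H′)
Partners-addPendantPath I {H} {H′} partners = record
  { surplus  = Surplus-addPendantPath surplus
  ; back     = trans (pair-addPendantPath I H′) (cong (Maybe.map addPendantPath) back)
  ; adjacent = Sum.map Arc-block-inner Arc-block-inner adjacent
  }
  where open Partners partners

Partners-toggleRow : ∀ {t} {ρ : Subset s} {H : Graph q (suc s)} → Nonempty ρ → Surplus H →
                     Partners (block true (t ∷ ρ) ∅ H) (block true (not t ∷ ρ) ∅ H)
Partners-toggleRow {t = t} {ρ} {H} (i , i∈ρ) surplus = record
  { surplus  = Equivalence.from (Surplus-block-true-∅ (t ∷ ρ) H) (surplus , suc i , there i∈ρ)
  ; back     = trans (pair-of (toggleRow refl (i , i∈ρ) surplus))
                     (cong (λ x → just (block true (x ∷ ρ) ∅ H)) (not-involutive t))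
  ; adjacent = adjacent t
  }
  where
  adjacent : ∀ t → Arc (block true (t ∷ ρ) ∅ H) (block true (not t ∷ ρ) ∅ H) ⊎
                   Arc (block true (not t ∷ ρ) ∅ H) (block true (t ∷ ρ) ∅ H)
  adjacent true  = inj₁ (zero , suc zero , refl , refl)
  adjacent false = inj₂ (zero , suc zero , refl , refl)

Partners-toggleCorner : ∀ {b ρ c} {H : Graph q s} → Nonempty c → Surplus (block false ρ c H) →
                        Partners (block b ρ c H) (block (not b) ρ c H)
Partners-toggleCorner {b = b} {ρ} {c} {H} c≢∅ surplus₀ = record
  { surplus  = surplus b
  ; back     = trans (pair-of (toggleCorner c≢∅ surplus₀)) (cong (λ x → just (block x ρ c H)) (not-involutive b))
  ; adjacent = adjacent b
  }
  where
  surplus : ∀ b → Surplus (block b ρ c H)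
  surplus false = surplus₀
  surplus true  = Surplus-mono (block-false⊆ᴳblock-true ρ c H) surplus₀

  adjacent : ∀ b → Arc (block b ρ c H) (block (not b) ρ c H) ⊎ Arc (block (not b) ρ c H) (block b ρ c H)
  adjacent true  = inj₁ (zero , zero , refl , refl)
  adjacent false = inj₂ (zero , zero , refl , refl)

module InnerToggle {ρ : Subset s} {c : Subset q} {H : Graph q s} {m z} (c≢∅ : Nonempty c)
                   (surplus : Surplus (block true ρ c H)) (m∈c : m ∈ₛ c) (witnessed : Witnessed ρ c H z) where

  H′ : Graph q s
  H′ = toggleEdge H m z

  rows≡ : ∀ {i} → i ≢ m → lookup H′ i ≡ lookup H i
  rows≡ = lookup-toggleEdge′ H z

  witnessed′ : Witnessed ρ c H′ z
  witnessed′ = Witnessed-rows {H = H} {H′} m∈c (sym ∘ rows≡) witnessed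

  surplus′ : Surplus (block true ρ c H′)
  surplus′ with toggleEdge-cases H m z
  ... | inj₁ (_ , H′≡) =
    subst (λ H″ → Surplus (block true ρ c H″)) (sym H′≡) (Surplus-removeEdge-witnessed surplus m∈c witnessed)
  ... | inj₂ (e , H≡)  = Surplus-mono (Arc⇒⊆ᴳ (Arc-block-inner (m , z , e , H≡))) surplus

  spec′ : KindSpec true ρ c H′ toggleInner
  spec′ = toggleInner c≢∅ surplus′ (Witness⇒¬Surplus (proj₁ (proj₂ witnessed′)))

  firstWitnessed≡ : firstWitnessed ρ c H′ ≡ firstWitnessed ρ c H
  firstWitnessed≡ =
    Least-unique (Witnessed-rows {H = H′} {H} m∈c rows≡) (Witnessed-rows {H = H} {H′} m∈c (sym ∘ rows≡))
                 (proj₂ (least _)) (proj₂ (least _))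

  adjacent : Arc (block true ρ c H) (block true ρ c H′) ⊎ Arc (block true ρ c H′) (block true ρ c H)
  adjacent = Sum.map (λ (e , eq) → Arc-block-inner (m , z , e , eq)) (λ (e , eq) → Arc-block-inner (m , z , e , eq))
                     (toggleEdge-cases H m z)

  module _ (inner≡ : innerEdge ρ c H ≡ just (m , z)) where

    inner≡′ : innerEdge ρ c H′ ≡ just (m , z)
    inner≡′ = trans (cong (Maybe.zip (firstMember c)) firstWitnessed≡) inner≡

    potential′ : potential (block true ρ c H′) ≡ 4 ∷ ∣ c ∣ ∷ innerKey (numEdges (block true ρ c H′)) H′ (m , z)
    potential′ = trans (potential-of spec′)
                       (cong (λ e → 4 ∷ ∣ c ∣ ∷ Maybe.maybe′ (innerKey (numEdges (block true ρ c H′)) H′) [] e) inner≡′)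

    partners : Partners (block true ρ c H) (block true ρ c H′)
    partners = record { surplus = surplus ; back = back ; adjacent = adjacent }
      where
      open ≡-Reasoning
      back : pair (block true ρ c H′) ≡ just (block true ρ c H)
      back = begin
        pair (block true ρ c H′)
          ≡⟨ pair-of spec′ ⟩
        Maybe.map (λ (m , z) → block true ρ c (toggleEdge H′ m z)) (innerEdge ρ c H′)
          ≡⟨ cong (Maybe.map (λ (m , z) → block true ρ c (toggleEdge H′ m z))) inner≡′ ⟩
        just (block true ρ c (toggleEdge H′ m z))
          ≡⟨ cong (λ X → just (block true ρ c X)) (toggleEdge-involutive H m z) ⟩
        just (block true ρ c H)
          ∎

partners-block : Invariants (suc q) s → Invariants q s → ∀ {b ρ c} {H : Graph q s} {k τ} →
                 KindSpec b ρ c H k → pairBlock k b ρ c H ≡ just τ → Partners (block b ρ c H) τ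
partners-block I₁ I₂ (deficient _) ()
partners-block I₁ I₂ {ρ = ρ} {H = H} (isolatedColumn refl _) σ↦τ with pair (ρ ∷ H) in X↦Y
... | just Y with refl ← σ↦τ =
  subst (λ σ → Partners σ (addIsolatedColumn Y)) (sym (block-isolatedColumn ρ H))
        (Partners-addIsolatedColumn I₁ (Invariants.partners I₁ X↦Y))
partners-block I₁ I₂ {H = H} (pendantPath refl refl _) σ↦τ with pair H in H↦H′
... | just H′ with refl ← σ↦τ = Partners-addPendantPath I₂ (Invariants.partners I₂ H↦H′)
partners-block I₁ I₂ {ρ = t ∷ ρ} (toggleRow refl tail≢∅ surplus) refl = Partners-toggleRow tail≢∅ surplus
partners-block I₁ I₂ (toggleCorner c≢∅ surplus₀) refl = Partners-toggleCorner c≢∅ surplus₀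
partners-block I₁ I₂ {ρ = ρ} {c} {H} (toggleInner c≢∅ surplus ¬surplus₀) σ↦τ
  with innerEdge-just c≢∅ surplus ¬surplus₀
... | m , z , first≡m , first≡z , m∈c , witnessed
  with inner≡ ← cong₂ Maybe.zip first≡m first≡z rewrite inner≡ with refl ← σ↦τ =
  InnerToggle.partners c≢∅ surplus m∈c witnessed inner≡

addIsolatedColumn∈L : ∀ {X : Graph (suc q) s} → X ∈ L (suc q) s → addIsolatedColumn X ∈ L (suc q) (suc s)
addIsolatedColumn∈L {s = suc s} X∈L = ∈-++⁺ˡ (∈-map⁺ addIsolatedColumn X∈L)

addPendantPath∈L : ∀ {H : Graph q (suc s)} → H ∈ L q (suc s) → addPendantPath H ∈ L (suc q) (suc (suc s))
addPendantPath∈L H∈L = ∈-++⁺ʳ _ (∈-map⁺ addPendantPath H∈L)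

unpaired-block : Invariants (suc q) s → Invariants q s → ∀ {b ρ c} {H : Graph q s} {k} →
                 KindSpec b ρ c H k → Surplus (block b ρ c H) → pairBlock k b ρ c H ≡ nothing →
                 block b ρ c H ∈ L (suc q) (suc s)
unpaired-block I₁ I₂ (deficient ¬surplus) surplus _ = contradiction surplus ¬surplus
unpaired-block I₁ I₂ {ρ = ρ} {H = H} (isolatedColumn refl surplusX) _ unpaired with pair (ρ ∷ H) in X↦
... | nothing = subst (_∈ L _ _) (sym (block-isolatedColumn ρ H))
                      (addIsolatedColumn∈L (Invariants.unpaired⇒∈L I₁ surplusX X↦))
unpaired-block I₁ I₂ {H = H} (pendantPath refl refl surplusH) _ unpaired with pair H in H↦
... | nothing = addPendantPath∈L (Invariants.unpaired⇒∈L I₂ surplusH H↦)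
unpaired-block I₁ I₂ {ρ = t ∷ ρ} (toggleRow refl _ _) _ ()
unpaired-block I₁ I₂ (toggleCorner _ _) _ ()
unpaired-block I₁ I₂ (toggleInner c≢∅ surplus ¬surplus₀) _ unpaired
  with innerEdge-just c≢∅ surplus ¬surplus₀
... | m , z , first≡m , first≡z , _ rewrite first≡m | first≡z with () ← unpaired

∈L⇒unpaired-step : Invariants (suc q) s → Invariants q s → ∀ {σ} → σ ∈ L (suc q) (suc s) →
                   pair σ ≡ nothing × Surplus σ × numEdges σ ≡ 2 * suc q
∈L⇒unpaired-step {q} {suc s} I₁ I₂ σ∈L with ∈-++⁻ (List.map addIsolatedColumn (L (suc q) (suc s))) σ∈L
... | inj₁ σ∈₁ with ∈-map⁻ addIsolatedColumn σ∈₁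
...   | X , X∈L , refl with Invariants.∈L⇒unpaired I₁ X∈L
...     | unpaired , surplus , edges =
  trans (pair-addIsolatedColumn I₁ X) (cong (Maybe.map addIsolatedColumn) unpaired) ,
  Equivalence.from (Surplus-addIsolatedColumn X) surplus ,
  trans (numEdges-addIsolatedColumn X) edges
∈L⇒unpaired-step {q} {suc s} I₁ I₂ σ∈L | inj₂ σ∈₂ with ∈-map⁻ addPendantPath σ∈₂
...   | H , H∈L , refl with Invariants.∈L⇒unpaired I₂ H∈L
...     | unpaired , surplus , edges =
  trans (pair-addPendantPath I₂ H) (cong (Maybe.map addPendantPath) unpaired) ,
  Surplus-addPendantPath surplus ,
  trans (numEdges-addPendantPath H) (trans (cong (2 +_) edges) (sym (*-suc 2 q)))

by-rank : ∀ {m n xs ys} {m<n : True (m <? n)} → m ∷ xs ≺ n ∷ ys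
by-rank {m<n = m<n} = this (toWitness m<n)

weight-mono : ∀ x {e e′} → e′ < e → weight e′ x < weight e x
weight-mono true  e′<e = e′<e
weight-mono false e′<e = s≤s (s≤s e′<e)

weight-toggle : ∀ {σ τ : Graph q s} → Arc σ τ → weight (numEdges σ) true < weight (numEdges τ) false
weight-toggle σ→τ rewrite sym (Arc⇒numEdges σ→τ) = ≤-refl

kind-deficient : ∀ {b ρ c} {H : Graph q s} {k} → KindSpec b ρ c H k → ¬ Surplus (block b ρ c H) → k ≡ deficient
kind-deficient (deficient _) _ = refl
kind-deficient {ρ = ρ} {H = H} (isolatedColumn refl surplus) ¬surplus =
  contradiction (Equivalence.from (Surplus-block-false-∅ ρ H) surplus) ¬surplus
kind-deficient (pendantPath refl refl surplus) ¬surplus = contradiction (Surplus-addPendantPath surplus) ¬surplus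
kind-deficient {ρ = t ∷ ρ} (toggleRow refl tail≢∅ surplus) ¬surplus =
  contradiction (Partners.surplus (Partners-toggleRow tail≢∅ surplus)) ¬surplus
kind-deficient (toggleCorner c≢∅ surplus₀) ¬surplus =
  contradiction (Partners.surplus (Partners-toggleCorner c≢∅ surplus₀)) ¬surplus
kind-deficient (toggleInner _ surplus _) ¬surplus = contradiction surplus ¬surplus

descends-isolated : Invariants (suc q) s → ∀ {ρ ρ′} {H H′ : Graph q s} → Arc (ρ ∷ H) (ρ′ ∷ H′) →
                    Maybe.map addIsolatedColumn (pair (ρ ∷ H)) ≢ just (block false ρ′ ∅ H′) →
                    potential (ρ′ ∷ H′) ≺ potential (ρ ∷ H)
descends-isolated I {ρ′ = ρ′} {H′ = H′} X→Y ¬paired = Invariants.descends I (inj₁ (X→Y , λ (X↦Y , _) →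
  ¬paired (trans (cong (Maybe.map addIsolatedColumn) X↦Y) (cong just (sym (block-isolatedColumn ρ′ H′))))))

descend-isolatedColumn : Invariants (suc q) s → ∀ {ρ} {H : Graph q s} {b′ ρ′ c′ H′ k′} →
                         KindSpec b′ ρ′ c′ H′ k′ → BlockArc false ρ ∅ H b′ ρ′ c′ H′ →
                         Maybe.map addIsolatedColumn (pair (ρ ∷ H)) ≢ just (block b′ ρ′ c′ H′) →
                         rank k′ ∷ tiebreak k′ b′ ρ′ c′ H′ ≺ 1 ∷ potential (ρ ∷ H)
descend-isolatedColumn I (deficient _)             _             _ = by-rank
descend-isolatedColumn I _                         (corner ())   _
descend-isolatedColumn I _                         (column i∈∅)  _ = contradiction i∈∅ ∉⊥
descend-isolatedColumn I (toggleCorner c≢∅ _)      (row _)       _ = contradiction c≢∅ Empty-∅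
descend-isolatedColumn I (toggleCorner c≢∅ _)      (inner _)     _ = contradiction c≢∅ Empty-∅
descend-isolatedColumn I {ρ} {H} (isolatedColumn _ _) (row {j} j∈ρ) ¬paired =
  next refl (descends-isolated I (zero , j , []=⇒lookup j∈ρ , cong (_∷ H) (sym ([]≔outside≡- ρ j))) ¬paired)
descend-isolatedColumn I (isolatedColumn _ _) (inner {i} {j} e) ¬paired =
  next refl (descends-isolated I (suc i , j , e , refl) ¬paired)

descend-pendantPath : Invariants q (suc s) → ∀ {H : Graph q (suc s)} {b′ ρ′ c′ H′ k′} →
                      KindSpec b′ ρ′ c′ H′ k′ → BlockArc true (inside ∷ ∅) ∅ H b′ ρ′ c′ H′ →
                      Maybe.map addPendantPath (pair H) ≢ just (block b′ ρ′ c′ H′) →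
                      rank k′ ∷ tiebreak k′ b′ ρ′ c′ H′ ≺ 2 ∷ potential H
descend-pendantPath I (deficient _)          _                   _ = by-rank
descend-pendantPath I (isolatedColumn _ _)   _                   _ = by-rank
descend-pendantPath I (toggleCorner c≢∅ _)   arc                 _ = contradiction c≢∅ (Empty-column arc)
descend-pendantPath I (toggleInner c≢∅ _ _)  arc                 _ = contradiction c≢∅ (Empty-column arc)
descend-pendantPath I _                      (row (there j∈∅))   _ = contradiction j∈∅ ∉⊥
descend-pendantPath I _                      (column i∈∅)        _ = contradiction i∈∅ ∉⊥
descend-pendantPath I (pendantPath _ ρ′≡ _)  (row here)          _ = contradiction (∷-injectiveˡ ρ′≡) λ ()
descend-pendantPath I (toggleRow _ tail≢∅ _) (row here)          _ =
  contradiction tail≢∅ λ (_ , x∈) → ∉⊥ (p─q⊆p _ _ x∈)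
descend-pendantPath I (toggleRow _ tail≢∅ _) (inner _)           _ = contradiction tail≢∅ Empty-∅
descend-pendantPath I (pendantPath _ _ _)    (inner {i} {j} e)   ¬paired =
  next refl (Invariants.descends I
    (inj₁ ((i , j , e , refl) , λ (H↦H′ , _) → ¬paired (cong (Maybe.map addPendantPath) H↦H′))))

descend-toggleRow : ∀ {t} {ρ : Subset s} {H : Graph q (suc s)} {b′ ρ′ c′ H′ k′} →
                    KindSpec b′ ρ′ c′ H′ k′ → BlockArc true (t ∷ ρ) ∅ H b′ ρ′ c′ H′ →
                    just (block true (not t ∷ ρ) ∅ H) ≢ just (block b′ ρ′ c′ H′) →
                    suc (numEdges (block b′ ρ′ c′ H′)) ≡ numEdges (block true (t ∷ ρ) ∅ H) →
                    rank k′ ∷ tiebreak k′ b′ ρ′ c′ H′ ≺ 3 ∷ weight (numEdges (block true (t ∷ ρ) ∅ H)) t ∷ []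
descend-toggleRow (deficient _)          _                 _       _     = by-rank
descend-toggleRow (isolatedColumn _ _)   _                 _       _     = by-rank
descend-toggleRow (pendantPath _ _ _)    _                 _       _     = by-rank
descend-toggleRow (toggleCorner c≢∅ _)   arc               _       _     = contradiction c≢∅ (Empty-column arc)
descend-toggleRow (toggleInner c≢∅ _ _)  arc               _       _     = contradiction c≢∅ (Empty-column arc)
descend-toggleRow _                      (column i∈∅)      _       _     = contradiction i∈∅ ∉⊥
descend-toggleRow {ρ = ρ} {H} (toggleRow _ _ _) (row here) ¬paired _ =
  contradiction (cong (λ ρ′ → just (block true (outside ∷ ρ′) ∅ H)) (sym (p─⊥≡p ρ))) ¬paired
descend-toggleRow {t = t} (toggleRow _ _ _) (row (there _)) _ edges = next refl (this (weight-mono t (≤-reflexive edges)))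
descend-toggleRow {t = t} (toggleRow _ _ _) (inner _)       _ edges = next refl (this (weight-mono t (≤-reflexive edges)))

inner-tiebreak : ∀ {ρ ρ′ c} {H H′ : Graph q s} → Nonempty c → Surplus (block true ρ c H) →
                 ¬ Surplus (block false ρ c H) → Surplus (block true ρ′ c H′) → ρ′ ⊆ ρ → H′ ⊆ᴳ H →
                 numEdges (block true ρ′ c H′) < numEdges (block true ρ c H) →
                 (∀ {m z} → innerEdge ρ c H ≡ just (m , z) → lookup (lookup H′ m) z ≡ lookup (lookup H m) z) →
                 tiebreak toggleInner true ρ′ c H′ ≺ tiebreak toggleInner true ρ c H
inner-tiebreak {ρ = ρ} {ρ′} {c} {H} {H′} c≢∅ surplus ¬surplus₀ surplus′ ρ′⊆ρ H′⊆H fewer same-entry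
  with innerEdge-just c≢∅ surplus ¬surplus₀
... | m , z , first≡m , first≡z , m∈c , witnessed
  with least-just (witnessed? ρ′ c H′) (Witnessed-⊆ surplus′ ρ′⊆ρ H′⊆H witnessed)
... | z′ , first≡z′ , _ , z′≤z
  rewrite first≡m | first≡z | first≡z′ = next refl (compare (m≤n⇒m<n∨m≡n z′≤z))
  where
  compare : toℕ z′ < toℕ z ⊎ toℕ z′ ≡ toℕ z →
            innerKey (numEdges (block true ρ′ c H′)) H′ (m , z′) ≺ innerKey (numEdges (block true ρ c H)) H (m , z)
  compare (inj₁ z′<z) = this z′<z
  compare (inj₂ z′≡z) with toℕ-injective z′≡z
  ... | refl = next refl (this (subst (λ x → weight _ x < weight _ (lookup (lookup H m) z))
                                      (sym (same-entry refl))
                                      (weight-mono (lookup (lookup H m) z) fewer)))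

descend-toggleInner : ∀ {ρ c} {H : Graph q s} → Nonempty c → Surplus (block true ρ c H) → ¬ Surplus (block false ρ c H) →
                      ∀ {b′ ρ′ c′ H′ k′} → KindSpec b′ ρ′ c′ H′ k′ → BlockArc true ρ c H b′ ρ′ c′ H′ →
                      pairBlock toggleInner true ρ c H ≢ just (block b′ ρ′ c′ H′) →
                      suc (numEdges (block b′ ρ′ c′ H′)) ≡ numEdges (block true ρ c H) →
                      rank k′ ∷ tiebreak k′ b′ ρ′ c′ H′ ≺ 4 ∷ tiebreak toggleInner true ρ c H
descend-toggleInner _ _ _          (deficient _)            _ _ _ = by-rank
descend-toggleInner _ _ _          (isolatedColumn _ _)     _ _ _ = by-rank
descend-toggleInner _ _ _          (pendantPath _ _ _)      _ _ _ = by-rank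
descend-toggleInner _ _ _          (toggleRow _ _ _)        _ _ _ = by-rank
descend-toggleInner _ _ ¬surplus₀  (toggleCorner _ surplus₀′) arc _ _ =
  contradiction surplus₀′ (¬Surplus-without-corner ¬surplus₀ arc)
descend-toggleInner _ _ _          (toggleInner _ _ _)      (column i∈c) _ _ = next refl (this (x∈p⇒∣p-x∣<∣p∣ i∈c))
descend-toggleInner {ρ = ρ} c≢∅ surplus ¬surplus₀ (toggleInner _ surplus′ _) (row j∈ρ) _ edges =
  next refl (inner-tiebreak c≢∅ surplus ¬surplus₀ surplus′ (p─q⊆p ρ _) (rows-⊆ λ _ x∈ → x∈) (≤-reflexive edges) (λ _ → refl))
descend-toggleInner {ρ = ρ} {c} {H} c≢∅ surplus ¬surplus₀ (toggleInner _ surplus′ _) (inner {i} {j} e) ¬paired edges =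
  next refl (inner-tiebreak c≢∅ surplus ¬surplus₀ surplus′ (λ x∈ → x∈) (removeEdge-⊆ᴳ H i j) (≤-reflexive edges) same-entry)
  where
  same-entry : ∀ {m z} → innerEdge ρ c H ≡ just (m , z) → lookup (lookup (removeEdge H i j) m) z ≡ lookup (lookup H m) z
  same-entry {m} {z} inner≡ with m ≟ i | z ≟ j
  ... | yes refl | yes refl = contradiction
          (trans (cong (Maybe.map (λ (m , z) → block true ρ c (toggleEdge H m z))) inner≡)
                 (cong (λ X → just (block true ρ c X)) (toggleEdge-removeEdge H e)))
          ¬paired
  ... | no m≢i   | _        = lookup-removeEdge-other H (inj₁ m≢i)
  ... | yes _    | no z≢j   = lookup-removeEdge-other H (inj₂ z≢j)

descend-toggleCorner : ∀ {b ρ c} {H : Graph q s} {b′ ρ′ c′ H′ k′} →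
                       KindSpec b′ ρ′ c′ H′ k′ → BlockArc b ρ c H b′ ρ′ c′ H′ →
                       just (block (not b) ρ c H) ≢ just (block b′ ρ′ c′ H′) →
                       suc (numEdges (block b′ ρ′ c′ H′)) ≡ numEdges (block b ρ c H) →
                       rank k′ ∷ tiebreak k′ b′ ρ′ c′ H′ ≺ 5 ∷ weight (numEdges (block b ρ c H)) b ∷ []
descend-toggleCorner (deficient _)          _             _       _     = by-rank
descend-toggleCorner (isolatedColumn _ _)   _             _       _     = by-rank
descend-toggleCorner (pendantPath _ _ _)    _             _       _     = by-rank
descend-toggleCorner (toggleRow _ _ _)      _             _       _     = by-rank
descend-toggleCorner (toggleInner _ _ _)    _             _       _     = by-rank
descend-toggleCorner (toggleCorner _ _)     (corner refl) ¬paired _     = contradiction refl ¬paired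
descend-toggleCorner {b = b} (toggleCorner _ _) (row _)    _ edges = next refl (this (weight-mono b (≤-reflexive edges)))
descend-toggleCorner {b = b} (toggleCorner _ _) (column _) _ edges = next refl (this (weight-mono b (≤-reflexive edges)))
descend-toggleCorner {b = b} (toggleCorner _ _) (inner _)  _ edges = next refl (this (weight-mono b (≤-reflexive edges)))

descend : Invariants (suc q) s → Invariants q s → ∀ {b b′ ρ ρ′ c c′} {H H′ : Graph q s} {k k′} →
          KindSpec b ρ c H k → KindSpec b′ ρ′ c′ H′ k′ → Arc (block b ρ c H) (block b′ ρ′ c′ H′) →
          pairBlock k b ρ c H ≢ just (block b′ ρ′ c′ H′) →
          rank k′ ∷ tiebreak k′ b′ ρ′ c′ H′ ≺ rank k ∷ tiebreak k b ρ c H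
descend I₁ I₂ (deficient ¬surplus) sᵥ u→v _ with kind-deficient sᵥ (¬surplus ∘ Surplus-mono (Arc⇒⊆ᴳ u→v))
... | refl = next refl (this (≤-reflexive (Arc⇒numEdges u→v)))
descend I₁ I₂ (isolatedColumn refl _) sᵥ u→v ¬paired = descend-isolatedColumn I₁ sᵥ (Arc⇒BlockArc u→v) ¬paired
descend I₁ I₂ (pendantPath refl refl _) sᵥ u→v ¬paired = descend-pendantPath I₂ sᵥ (Arc⇒BlockArc u→v) ¬paired
descend I₁ I₂ {ρ = t ∷ ρ} (toggleRow refl _ _) sᵥ u→v ¬paired =
  descend-toggleRow sᵥ (Arc⇒BlockArc u→v) ¬paired (Arc⇒numEdges u→v)
descend I₁ I₂ (toggleInner c≢∅ surplus ¬surplus₀) sᵥ u→v ¬paired =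
  descend-toggleInner c≢∅ surplus ¬surplus₀ sᵥ (Arc⇒BlockArc u→v) ¬paired (Arc⇒numEdges u→v)
descend I₁ I₂ (toggleCorner _ _) sᵥ u→v ¬paired = descend-toggleCorner sᵥ (Arc⇒BlockArc u→v) ¬paired (Arc⇒numEdges u→v)

ascend : Invariants (suc q) s → Invariants q s → ∀ {b ρ c} {H : Graph q s} {k u} →
         KindSpec b ρ c H k → pairBlock k b ρ c H ≡ just u → Arc (block b ρ c H) u →
         rank k ∷ tiebreak k b ρ c H ≺ potential u
ascend I₁ I₂ (deficient _) ()
ascend I₁ I₂ {ρ = ρ} {H = H} (isolatedColumn refl _) v↦u v→u with pair (ρ ∷ H) in X↦Y
... | just Y with refl ← v↦u
  with Arc-addIsolatedColumn⁻ (subst (λ v → Arc v (addIsolatedColumn Y)) (block-isolatedColumn ρ H) v→u)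
...   | Y′ , u≡ , X→Y′ with refl ← addIsolatedColumn-injective u≡ =
  subst (1 ∷ potential (ρ ∷ H) ≺_) (sym (potential-addIsolatedColumn (Surplus-partner I₁ X↦Y)))
        (next refl (Invariants.descends I₁ (inj₂ (X↦Y , X→Y′))))
ascend I₁ I₂ {H = H} (pendantPath refl refl _) v↦u v→u with pair H in H↦H′
... | just H′ with refl ← v↦u =
  subst (2 ∷ potential H ≺_) (sym (potential-addPendantPath (Surplus-partner I₂ H↦H′)))
        (next refl (Invariants.descends I₂ (inj₂ (H↦H′ , Arc-block-inner⁻ v→u refl refl refl))))
ascend I₁ I₂ {ρ = t ∷ ρ} {H = H} (toggleRow refl tail≢∅ surplus) refl v→u =
  subst (λ p → 3 ∷ weight (numEdges (block true (t ∷ ρ) ∅ H)) t ∷ [] ≺ p)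
        (sym (potential-of (toggleRow refl tail≢∅ surplus))) (next refl (this (up t v→u)))
  where
  up : ∀ t → Arc (block true (t ∷ ρ) ∅ H) (block true (not t ∷ ρ) ∅ H) →
       weight (numEdges (block true (t ∷ ρ) ∅ H)) t < weight (numEdges (block true (not t ∷ ρ) ∅ H)) (not t)
  up true  v→u = weight-toggle v→u
  up false v→u = contradiction (zero , suc zero , refl , refl) (Arc-asym v→u)
ascend I₁ I₂ {b = b} {ρ} {c} {H} (toggleCorner c≢∅ surplus₀) refl v→u =
  subst (λ p → 5 ∷ weight (numEdges (block b ρ c H)) b ∷ [] ≺ p)
        (sym (potential-of (toggleCorner c≢∅ surplus₀))) (next refl (this (up b v→u)))
  where
  up : ∀ b → Arc (block b ρ c H) (block (not b) ρ c H) →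
       weight (numEdges (block b ρ c H)) b < weight (numEdges (block (not b) ρ c H)) (not b)
  up true  v→u = weight-toggle v→u
  up false v→u = contradiction (zero , zero , refl , refl) (Arc-asym v→u)
ascend I₁ I₂ {ρ = ρ} {c} {H} (toggleInner c≢∅ surplus ¬surplus₀) v↦u v→u
  with innerEdge-just c≢∅ surplus ¬surplus₀
... | m , z , first≡m , first≡z , m∈c , witnessed
  with inner≡ ← cong₂ Maybe.zip first≡m first≡z rewrite inner≡ with refl ← v↦u =
  subst (λ p → 4 ∷ ∣ c ∣ ∷ innerKey (numEdges (block true ρ c H)) H (m , z) ≺ p)
        (sym (InnerToggle.potential′ c≢∅ surplus m∈c witnessed inner≡))
        (next refl (next refl (next refl (this (up v→u)))))
  where
  H′ = toggleEdge H m z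
  up : Arc (block true ρ c H) (block true ρ c H′) →
       weight (numEdges (block true ρ c H)) (lookup (lookup H m) z) <
       weight (numEdges (block true ρ c H′)) (lookup (lookup H′ m) z)
  up v→u with toggleEdge-cases H m z
  ... | inj₁ (present , _)  rewrite lookup-toggleEdge H m z | present = weight-toggle v→u
  ... | inj₂ (present′ , H≡) = contradiction (Arc-block-inner (m , z , present′ , H≡)) (Arc-asym v→u)

partners-step : Invariants (suc q) s → Invariants q s →
                ∀ {σ τ : Graph (suc q) (suc s)} → pair σ ≡ just τ → Partners σ τ
partners-step I₁ I₂ {σ} σ↦τ with blockView σ
... | block-view b ρ c H = partners-block I₁ I₂ (kind-spec b ρ c H) (trans (sym (pair-block b ρ c H)) σ↦τ)

unpaired⇒∈L-step : Invariants (suc q) s → Invariants q s →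
                   ∀ {σ : Graph (suc q) (suc s)} → Surplus σ → pair σ ≡ nothing → σ ∈ L (suc q) (suc s)
unpaired⇒∈L-step I₁ I₂ {σ} surplus unpaired with blockView σ
... | block-view b ρ c H = unpaired-block I₁ I₂ (kind-spec b ρ c H) surplus (trans (sym (pair-block b ρ c H)) unpaired)

descends-step : Invariants (suc q) s → Invariants q s →
                ∀ {u v : Graph (suc q) (suc s)} → Reversed (Paired pair) u v → potential v ≺ potential u
descends-step I₁ I₂ {u} {v} (inj₁ (u→v , ¬paired)) with blockView u | blockView v
... | block-view b ρ c H | block-view b′ ρ′ c′ H′ =
  subst₂ _≺_ (sym (potential-block b′ ρ′ c′ H′)) (sym (potential-block b ρ c H))
    (descend I₁ I₂ (kind-spec b ρ c H) (kind-spec b′ ρ′ c′ H′) u→v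
      λ u↦v → ¬paired (trans (pair-block b ρ c H) u↦v , u→v))
descends-step I₁ I₂ {u} {v} (inj₂ (v↦u , v→u)) with blockView v
... | block-view b ρ c H =
  subst (_≺ potential u) (sym (potential-block b ρ c H))
    (ascend I₁ I₂ (kind-spec b ρ c H) (trans (sym (pair-block b ρ c H)) v↦u) v→u)

invariants : ∀ q s → Invariants q s
invariants zero s = record
  { partners     = λ ()
  ; unpaired⇒∈L = λ { {[]} _ _ → Any.here refl }
  ; ∈L⇒unpaired = λ { (Any.here refl) → refl , (λ _ ()) , refl }
  ; descends     = λ { (inj₁ ((() , _) , _)) ; (inj₂ (() , _)) }
  }
invariants (suc q) zero = record
  { partners     = λ ()
  ; unpaired⇒∈L = λ {σ} surplus _ → contradiction (Surplus⇒q<s σ surplus) λ ()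
  ; ∈L⇒unpaired = λ ()
  ; descends     = λ { (inj₁ ((_ , () , _) , _)) ; (inj₂ (() , _)) }
  }
invariants (suc q) (suc s) = record
  { partners     = partners-step I₁ I₂
  ; unpaired⇒∈L = unpaired⇒∈L-step I₁ I₂
  ; ∈L⇒unpaired = ∈L⇒unpaired-step I₁ I₂
  ; descends     = descends-step I₁ I₂
  }
  where
  I₁ = invariants (suc q) s
  I₂ = invariants q s

L-unique : ∀ q s → Unique (L q s)
L-unique zero          s             = All.[] ∷ []
L-unique (suc q)       zero          = []
L-unique (suc q)       (suc zero)    = []
L-unique (suc q)       (suc (suc s)) =
  Unique.++⁺ (Unique.map⁺ addIsolatedColumn-injective (L-unique (suc q) (suc s)))
             (Unique.map⁺ addPendantPath-injective (L-unique q (suc s)))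
             disjoint
  where
  disjoint : ∀ {σ} → ¬ (σ ∈ List.map addIsolatedColumn (L (suc q) (suc s)) × σ ∈ List.map addPendantPath (L q (suc s)))
  disjoint (σ∈₁ , σ∈₂) with ∈-map⁻ addIsolatedColumn σ∈₁ | ∈-map⁻ addPendantPath σ∈₂
  ... | (_ ∷ _) , _ , refl | _ , _ , σ≡ with () ← proj₁ (∷-injective (proj₁ (∷-injective σ≡)))

L-length : ∀ q s → length (L q (suc s)) ≡ s C q
L-length zero    s       = refl
L-length (suc q) zero    = refl
L-length (suc q) (suc s) = begin
  length (List.map addIsolatedColumn (L (suc q) (suc s)) ++ List.map addPendantPath (L q (suc s)))
    ≡⟨ length-++ (List.map addIsolatedColumn (L (suc q) (suc s))) ⟩
  length (List.map addIsolatedColumn (L (suc q) (suc s))) + length (List.map addPendantPath (L q (suc s)))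
    ≡⟨ cong₂ _+_ (trans (length-map addIsolatedColumn (L (suc q) (suc s))) (L-length (suc q) s))
                 (trans (length-map addPendantPath (L q (suc s))) (L-length q s)) ⟩
  s C suc q + s C q
    ≡⟨ +-comm (s C suc q) (s C q) ⟩
  s C q + s C suc q
    ≡⟨ nCk+nC[k+1]≡[n+1]C[k+1] s q ⟩
  suc s C suc q
    ∎
  where open ≡-Reasoning

lemma3p2 : (q s : ℕ) → q < s →
    Σ (Graph q s → Graph q s → Set) λ M →
      MorseMatching M ×
      Σ (List (Graph q s)) λ L →
        Unique L ×
        length L ≡ (s ∸ 1) C q ×
        All (λ G → (numEdges G ≡ 2 * q) × FactorCritical G) L ×
        (∀ (σ : Graph q s) → Critical M σ ⇔ (NBFC σ ⊎ σ ∈ L))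
lemma3p2 q zero ()
lemma3p2 q (suc s) q<s =
  Paired pair , morseMatching I , L q (suc s) , L-unique q (suc s) , L-length q s , L-factorCritical I q<s ,
  λ σ → ⇔.trans (Critical⇔unpaired pair (pair-involutive I) (pair-adjacent I) σ)
                (⇔.trans (unpaired⇔ I σ) (¬Surplus⇔NBFC σ q<s ⊎-⇔ ⇔.refl))
  where
  I = invariants q (suc s)
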